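{- For all integers $m\ge 1$, $n\ge 1$ and $k_1,\ldots,k_m\ge 1$, $$t(M^{k_1,k_2,\ldots,k_m}K_{m,n})=n^{m-1}\,k_1k_2\cdots k_m\,(k_1+k_2+\cdots+k_m)^{n-1}.$$
   Context: Graphs may have multiple edges; $t(G)$ denotes the number of spanning trees of $G$, with parallel edges distinguished. The generalized complete bipartite graph $M^{k_1,\ldots,k_m}K_{m,n}$ has vertex set $V_1\cup V_2$ with $V_1=\{p_1,\ldots,p_n\}$ and $V_2=\{q_1,\ldots,q_m\}$, and for each $i\in\{1,\ldots,m\}$ and $j\in\{1,\ldots,n\}$ the vertices $q_i$ and $p_j$ are joined by exactly $k_i$ parallel edges; there are no other edges. -}

module Defs where

open import Data.Nat using (ℕ; _+_; _*_)
open import Data.Fin using (Fin; _↑ˡ_; _↑ʳ_)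
open import Data.Fin.Subset as Sub using (Subset)
open import Data.Bool using (Bool)
open import Data.List using (List; []; _∷_; length; concatMap; replicate; allFin)
open import Data.List.Relation.Unary.Unique.Propositional using (Unique)
open import Data.List.Membership.Propositional as LM using ()
open import Data.List.Relation.Unary.Any using (here)
open import Data.Product using (Σ; ∃; _×_; _,_)
open import Data.Sum using (_⊎_)
open import Relation.Binary.PropositionalEquality using (_≡_)
open import Relation.Nullary using (¬_)

-- A finite multigraph (loops and parallel edges allowed): vertices are Fin V,
-- edges are the POSITIONS of the edge list (so parallel edges are distinguished).
record Multigraph : Set where
  constructor mkGraph
  field
    V     : ℕ
    edges : List (Fin V × Fin V)

  E : ℕ
  E = length edges

  ends : Fin E → Fin V × Fin V
  ends = Data.List.lookup edges

open Multigraph public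

Joins : (G : Multigraph) → Fin (E G) → Fin (V G) → Fin (V G) → Set
Joins G e u w = (ends G e ≡ (u , w)) ⊎ (ends G e ≡ (w , u))

data Walk (G : Multigraph) (S : Subset (E G)) :
          Fin (V G) → Fin (V G) → List (Fin (E G)) → Set where
  stop : ∀ {u} → Walk G S u u []
  step : ∀ {u w v es} (e : Fin (E G)) → e Sub.∈ S → Joins G e u w →
         Walk G S w v es → Walk G S u v (e ∷ es)

Connected : (G : Multigraph) → Subset (E G) → Set
Connected G S = ∀ u v → ∃ λ es → Walk G S u v es

HasCycle : (G : Multigraph) → Subset (E G) → Set
HasCycle G S = Σ (Fin (V G)) λ u → Σ (Fin (E G)) λ e → Σ (List (Fin (E G))) λ es →
               Walk G S u u (e ∷ es) × Unique (e ∷ es)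

IsSpanningTree : (G : Multigraph) → Subset (E G) → Set
IsSpanningTree G S = Connected G S × ¬ HasCycle G S

SpanningTreeCount : Multigraph → ℕ → Set
SpanningTreeCount G N =
  Σ (List (Subset (E G))) λ L → Unique L × length L ≡ N ×
    (∀ S → (S LM.∈ L → IsSpanningTree G S) × (IsSpanningTree G S → S LM.∈ L))

-- M^{k_1..k_m} K_{m,n}: vertices Fin (n + m); p_j = j ↑ˡ m, q_i = n ↑ʳ i;
-- q_i and p_j joined by exactly k i parallel edges.
genCompleteBipartite : (m n : ℕ) → (Fin m → ℕ) → Multigraph
genCompleteBipartite m n k = mkGraph (n + m)
  (concatMap (λ i → concatMap (λ j → replicate (k i) ((n ↑ʳ i) , (j ↑ˡ m)))
                               (allFin n))
             (allFin m))

-- A spanning tree is a forest of all vertices rooted at p₁. A forest of a vertex set W rooted at R is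
-- peeled off layer by layer: each vertex of W ∖ R adjacent in the forest to a root picks its edge to R,
-- and what remains is a forest of W ∖ R rooted at the picking vertices. This bijection enumerates the
-- forests recursively, and since every edge joins a p to a q, the roots of successive layers alternate
-- between the two sides. For roots on one side the number of forests has a closed form (a weighted
-- version of r a^b (r + b)^(a-1) for the forests of K_{a,b+r} rooted at the r extra vertices); summing
-- the closed form for the other side over all choices of the next layer reproduces it, and for all
-- vertices rooted at p₁ it is n^(m-1) ∏ k (Σ k)^(n-1).

module Submission where

open import Defs
open import Data.Nat using (ℕ; zero; suc; _+_; _*_; _^_; _∸_; _≤_; _<_; z≤n; s≤s)
open import Data.Nat.Properties hiding (≡ᵇ⇒≡)
open import Data.Nat.Solver using (module +-*-Solver)
open import Data.Nat.ListAction using (sum; product)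
open import Data.Bool using (Bool; true; false; _∧_; _∨_; not; if_then_else_; T; T?)
import Data.Bool as Bool
open import Data.Bool.Properties using (T-≡; ∧-zeroʳ; ∨-zeroʳ; ∨-identityʳ; ¬-not)
open import Data.Fin using (Fin; zero; suc; _↑ˡ_; _↑ʳ_; splitAt)
import Data.Fin as Fin
open import Data.Fin.Properties using (splitAt-↑ˡ; splitAt-↑ʳ; splitAt⁻¹-↑ˡ; splitAt⁻¹-↑ʳ; ↑ˡ-injective; ↑ʳ-injective)
import Data.Fin.Subset as Sub
open import Data.Maybe using (Maybe; just; nothing; is-just)
import Data.Maybe as Maybe
open import Data.Maybe.Properties using (just-injective)
open import Data.Vec using (Vec; []; _∷_; lookup; tabulate)
open import Data.Vec.Properties
  using (tabulate∘lookup; tabulate-cong; lookup∘tabulate; lookup-replicate; []=⇒lookup; lookup⇒[]=; ∷-injective)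
open import Data.List using (List; []; _∷_; _++_; map; concatMap; length; replicate; allFin; filterᵇ; [_])
import Data.List as List
open import Data.List.Properties using (length-++; length-map)
open import Data.List.Membership.Propositional using (_∈_; find)
open import Data.List.Membership.Propositional.Properties
  using (∈-map⁺; ∈-map⁻; ∈-concat⁺′; ∈-concat⁻′; ∈-++⁺ʳ; ∈-++⁻; ∈-∃++; ∈-lookup; ∈-filter⁺; ∈-filter⁻; ∈-allFin)
import Data.List.Membership.DecPropositional as DecMembership
open import Data.List.Relation.Unary.Any using (here; there; any?)
open import Data.List.Relation.Unary.All as All using (All; []; _∷_)
open import Data.List.Relation.Unary.All.Properties using (¬Any⇒All¬)
open import Data.List.Relation.Unary.AllPairs using ([]; _∷_)
open import Data.List.Relation.Unary.Unique.Propositional using (Unique)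
open import Data.List.Relation.Unary.Unique.Propositional.Properties using (++⁺; allFin⁺; filter⁺; map⁺)
open import Data.Product using (Σ; ∃; ∃₂; _×_; _,_; proj₁; proj₂)
open import Data.Sum using (_⊎_; inj₁; inj₂; [_,_]′)
open import Data.Empty using (⊥; ⊥-elim)
open import Function using (_∘_; case_of_; Equivalence)
open import Relation.Nullary using (¬_; yes; no; does)
open import Relation.Binary.PropositionalEquality using (_≡_; _≢_; refl; sym; trans; cong; cong₂; subst; module ≡-Reasoning)
open +-*-Solver using (solve; _:=_; _:+_; _:*_; con)

𝟙 : Bool → ℕ
𝟙 true  = 1
𝟙 false = 0

false≢true : false ≢ true
false≢true ()

bool-cases : (b : Bool) → b ≡ true ⊎ b ≡ false
bool-cases true  = inj₁ refl
bool-cases false = inj₂ refl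

∧-true⁻ : ∀ {a b} → a ∧ b ≡ true → a ≡ true × b ≡ true
∧-true⁻ {true} {true} _ = refl , refl

∨-true⁻ : ∀ {a b} → a ∨ b ≡ true → a ≡ true ⊎ b ≡ true
∨-true⁻ {true}  _ = inj₁ refl
∨-true⁻ {false} h = inj₂ h

∨-true⁺ˡ : ∀ {a} b → a ≡ true → a ∨ b ≡ true
∨-true⁺ˡ b refl = refl

∨-true⁺ʳ : ∀ a {b} → b ≡ true → a ∨ b ≡ true
∨-true⁺ʳ true  _ = refl
∨-true⁺ʳ false h = h

not-∨-true⁻ : ∀ {a b} → not (a ∨ b) ≡ true → a ≡ false × b ≡ false
not-∨-true⁻ {false} {false} _ = refl , refl

∨-cancelʳ-disjoint : ∀ a b c → a ∨ c ≡ b ∨ c → (a ≡ true → c ≡ false) → (b ≡ true → c ≡ false) → a ≡ b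
∨-cancelʳ-disjoint true  true  c eq ac bc = refl
∨-cancelʳ-disjoint false false c eq ac bc = refl
∨-cancelʳ-disjoint true  false c eq ac bc = ⊥-elim (false≢true (trans (sym (ac refl)) (sym eq)))
∨-cancelʳ-disjoint false true  c eq ac bc = ⊥-elim (false≢true (trans (sym (bc refl)) eq))

_≡ᵇ_ : ∀ {N} → Fin N → Fin N → Bool
i ≡ᵇ j = does (i Fin.≟ j)

≡ᵇ⇒≡ : ∀ {N} {i j : Fin N} → i ≡ᵇ j ≡ true → i ≡ j
≡ᵇ⇒≡ {i = i} {j} h with i Fin.≟ j
... | yes p = p
... | no _  = ⊥-elim (false≢true h)

≡ᵇ-refl : ∀ {N} (i : Fin N) → i ≡ᵇ i ≡ true
≡ᵇ-refl i with i Fin.≟ i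
... | yes _  = refl
... | no i≢i = ⊥-elim (i≢i refl)

≢⇒≡ᵇ-false : ∀ {N} {i j : Fin N} → i ≢ j → i ≡ᵇ j ≡ false
≢⇒≡ᵇ-false {i = i} {j} i≢j with i Fin.≟ j
... | yes p = ⊥-elim (i≢j p)
... | no _  = refl

search : ∀ {N} → (Fin N → Bool) → Maybe (Fin N)
search {zero}  p = nothing
search {suc N} p with p zero
... | true  = just zero
... | false = Maybe.map suc (search (p ∘ suc))

search-just : ∀ {N} (p : Fin N → Bool) {i} → search p ≡ just i → p i ≡ true
search-just {suc N} p eq with p zero in p0
search-just {suc N} p refl | true = p0
search-just {suc N} p eq   | false with search (p ∘ suc) in s
search-just {suc N} p refl | false | just _ = search-just (p ∘ suc) s

search-nothing : ∀ {N} (p : Fin N → Bool) → search p ≡ nothing → ∀ i → p i ≡ false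
search-nothing {suc N} p eq i with p zero in p0
search-nothing {suc N} p () i | true
search-nothing {suc N} p eq i | false with search (p ∘ suc) in s
search-nothing {suc N} p eq zero    | false | nothing = p0
search-nothing {suc N} p eq (suc i) | false | nothing = search-nothing (p ∘ suc) s i

∈-concatMap⁺′ : ∀ {A B : Set} {f : A → List B} {x xs y} → x ∈ xs → y ∈ f x → y ∈ concatMap f xs
∈-concatMap⁺′ {f = f} x∈ y∈ = ∈-concat⁺′ y∈ (∈-map⁺ f x∈)

∈-concatMap⁻′ : ∀ {A B : Set} (f : A → List B) xs {y} → y ∈ concatMap f xs → ∃ λ x → x ∈ xs × y ∈ f x
∈-concatMap⁻′ f xs y∈ with ∈-concat⁻′ (map f xs) y∈
... | ys , y∈ys , ys∈ with ∈-map⁻ f ys∈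
... | x , x∈ , refl = x , x∈ , y∈ys

∈-filterᵇ⁺ : ∀ {A : Set} (p : A → Bool) {xs y} → y ∈ xs → p y ≡ true → y ∈ filterᵇ p xs
∈-filterᵇ⁺ p y∈ py = ∈-filter⁺ (T? ∘ p) y∈ (Equivalence.from T-≡ py)

∈-filterᵇ⁻ : ∀ {A : Set} (p : A → Bool) xs {y} → y ∈ filterᵇ p xs → y ∈ xs × p y ≡ true
∈-filterᵇ⁻ p xs y∈ = let y∈xs , py = ∈-filter⁻ (T? ∘ p) y∈ in y∈xs , Equivalence.to T-≡ py

∈-replicate⁻ : ∀ {A : Set} {c} {a x : A} → x ∈ replicate c a → x ≡ a
∈-replicate⁻ {c = suc c} (here refl) = refl
∈-replicate⁻ {c = suc c} (there x∈)  = ∈-replicate⁻ x∈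

unique-map⁺ : ∀ {A B : Set} (f : A → B) {xs : List A} → Unique xs →
  (∀ {x y} → x ∈ xs → y ∈ xs → f x ≡ f y → x ≡ y) → Unique (map f xs)
unique-map⁺ f {[]} [] inj = []
unique-map⁺ f {x ∷ xs} (x∉ ∷ u) inj =
  All.tabulate fx∉ ∷ unique-map⁺ f u (λ a b → inj (there a) (there b))
  where
  fx∉ : ∀ {z} → z ∈ map f xs → f x ≢ z
  fx∉ z∈ eq with ∈-map⁻ f z∈
  ... | y , y∈ , refl = All.lookup x∉ y∈ (inj (here refl) (there y∈) eq)

unique-concatMap⁺ : ∀ {A B : Set} (f : A → List B) {xs : List A} → Unique xs →
  (∀ {x} → x ∈ xs → Unique (f x)) →
  (∀ {x y z} → x ∈ xs → y ∈ xs → x ≢ y → z ∈ f x → z ∈ f y → ⊥) →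
  Unique (concatMap f xs)
unique-concatMap⁺ f {[]} [] uf dj = []
unique-concatMap⁺ f {x ∷ xs} (x∉ ∷ u) uf dj =
  ++⁺ (uf (here refl)) (unique-concatMap⁺ f u (uf ∘ there) (λ a b → dj (there a) (there b)))
      (λ (z∈ , z∈′) → disjoint z∈ z∈′)
  where
  disjoint : ∀ {z} → z ∈ f x → z ∈ concatMap f xs → ⊥
  disjoint z∈ z∈′ with ∈-concatMap⁻′ f xs z∈′
  ... | y , y∈ , z∈y = dj (here refl) (there y∈) (All.lookup x∉ y∈) z∈ z∈y

unique-++⁻ʳ : ∀ {A : Set} (xs : List A) {ys} → Unique (xs ++ ys) → Unique ys
unique-++⁻ʳ []       u       = u
unique-++⁻ʳ (x ∷ xs) (_ ∷ u) = unique-++⁻ʳ xs u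

unique-rotate-∉ : ∀ {A : Set} (pre : List A) {e post} → Unique (pre ++ e ∷ post) → All (_≢ e) (post ++ pre)
unique-rotate-∉ pre {e} {post} u = All.tabulate after-or-before
  where
  after : ∀ {f} → f ∈ post → f ≢ e
  after f∈ refl with unique-++⁻ʳ pre u
  ... | e∉ ∷ _ = All.lookup e∉ f∈ refl
  before : ∀ (pre : List _) {f} → Unique (pre ++ e ∷ post) → f ∈ pre → f ≢ e
  before (x ∷ pre) (x∉ ∷ _) (here refl) eq = All.lookup x∉ (∈-++⁺ʳ pre (here refl)) eq
  before (x ∷ pre) (_ ∷ u) (there f∈) eq = before pre u f∈ eq
  after-or-before : ∀ {f} → f ∈ post ++ pre → f ≢ e
  after-or-before f∈ with ∈-++⁻ post f∈
  ... | inj₁ a = after a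
  ... | inj₂ b = before pre u b

≡-by-just : ∀ {A : Set} {x y : Maybe A} → (∀ a → x ≡ just a → y ≡ just a) → (∀ a → y ≡ just a → x ≡ just a) → x ≡ y
≡-by-just {x = just a}  x⇒y y⇒x = sym (x⇒y a refl)
≡-by-just {x = nothing} {nothing} x⇒y y⇒x = refl
≡-by-just {x = nothing} {just a}  x⇒y y⇒x = case y⇒x a refl of λ ()

vec-ext : ∀ {A : Set} {N} (u v : Vec A N) → (∀ i → lookup u i ≡ lookup v i) → u ≡ v
vec-ext u v h = trans (sym (tabulate∘lookup u)) (trans (tabulate-cong h) (tabulate∘lookup v))

allVecs : ∀ {A : Set} {N} → (Fin N → List A) → List (Vec A N)
allVecs {N = zero}  O = [] ∷ []
allVecs {N = suc N} O = concatMap (λ a → map (a ∷_) (allVecs (O ∘ suc))) (O zero)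

∈-allVecs⁻ : ∀ {A : Set} {N} (O : Fin N → List A) {xs} → xs ∈ allVecs O → ∀ i → lookup xs i ∈ O i
∈-allVecs⁻ {N = suc N} O xs∈ i with ∈-concatMap⁻′ (λ a → map (a ∷_) (allVecs (O ∘ suc))) (O zero) xs∈
... | a , a∈ , ys∈ with ∈-map⁻ (a ∷_) ys∈
∈-allVecs⁻ {N = suc N} O xs∈ zero    | a , a∈ , ys∈ | ys , ys∈′ , refl = a∈
∈-allVecs⁻ {N = suc N} O xs∈ (suc i) | a , a∈ , ys∈ | ys , ys∈′ , refl = ∈-allVecs⁻ (O ∘ suc) ys∈′ i

∈-allVecs⁺ : ∀ {A : Set} {N} (O : Fin N → List A) (xs : Vec A N) → (∀ i → lookup xs i ∈ O i) → xs ∈ allVecs O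
∈-allVecs⁺ {N = zero}  O []       h = here refl
∈-allVecs⁺ {N = suc N} O (x ∷ xs) h =
  ∈-concatMap⁺′ {f = λ a → map (a ∷_) (allVecs (O ∘ suc))} (h zero) (∈-map⁺ (x ∷_) (∈-allVecs⁺ (O ∘ suc) xs (h ∘ suc)))

allVecs-unique : ∀ {A : Set} {N} (O : Fin N → List A) → (∀ i → Unique (O i)) → Unique (allVecs O)
allVecs-unique {N = zero}  O u = [] ∷ []
allVecs-unique {N = suc N} O u =
  unique-concatMap⁺ (λ a → map (a ∷_) (allVecs (O ∘ suc))) (u zero)
    (λ _ → map⁺ (proj₂ ∘ ∷-injective) (allVecs-unique (O ∘ suc) (u ∘ suc)))
    heads-differ
  where
  heads-differ : ∀ {x y z} → x ∈ O zero → y ∈ O zero → x ≢ y →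
                 z ∈ map (x ∷_) (allVecs (O ∘ suc)) → z ∈ map (y ∷_) (allVecs (O ∘ suc)) → ⊥
  heads-differ _ _ x≢y z∈x z∈y with ∈-map⁻ _ z∈x | ∈-map⁻ _ z∈y
  ... | _ , _ , refl | _ , _ , eq = x≢y (proj₁ (∷-injective eq))

sumL : ∀ {A : Set} → List A → (A → ℕ) → ℕ
sumL []       f = 0
sumL (x ∷ xs) f = f x + sumL xs f

sumL-cong : ∀ {A : Set} (xs : List A) {f g} → (∀ x → x ∈ xs → f x ≡ g x) → sumL xs f ≡ sumL xs g
sumL-cong []       h = refl
sumL-cong (x ∷ xs) h = cong₂ _+_ (h x (here refl)) (sumL-cong xs (λ y y∈ → h y (there y∈)))

sumL-++ : ∀ {A : Set} (xs ys : List A) f → sumL (xs ++ ys) f ≡ sumL xs f + sumL ys f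
sumL-++ []       ys f = refl
sumL-++ (x ∷ xs) ys f = trans (cong (f x +_) (sumL-++ xs ys f)) (sym (+-assoc (f x) _ _))

sumL-map : ∀ {A B : Set} (h : A → B) xs f → sumL (map h xs) f ≡ sumL xs (f ∘ h)
sumL-map h []       f = refl
sumL-map h (x ∷ xs) f = cong (f (h x) +_) (sumL-map h xs f)

sumL-concatMap : ∀ {A B : Set} (g : A → List B) xs f → sumL (concatMap g xs) f ≡ sumL xs (λ a → sumL (g a) f)
sumL-concatMap g []       f = refl
sumL-concatMap g (x ∷ xs) f = trans (sumL-++ (g x) (concatMap g xs) f) (cong (sumL (g x) f +_) (sumL-concatMap g xs f))

sumL-+ : ∀ {A : Set} (xs : List A) f g → sumL xs (λ x → f x + g x) ≡ sumL xs f + sumL xs g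
sumL-+ []       f g = refl
sumL-+ (x ∷ xs) f g rewrite sumL-+ xs f g =
  solve 4 (λ a b c d → (a :+ b) :+ (c :+ d) := (a :+ c) :+ (b :+ d)) refl (f x) (g x) (sumL xs f) (sumL xs g)

sumL-*ˡ : ∀ {A : Set} (xs : List A) c f → sumL xs (λ x → c * f x) ≡ c * sumL xs f
sumL-*ˡ []       c f = sym (*-zeroʳ c)
sumL-*ˡ (x ∷ xs) c f = trans (cong (c * f x +_) (sumL-*ˡ xs c f)) (sym (*-distribˡ-+ c (f x) _))

sumL-*ʳ : ∀ {A : Set} (xs : List A) c f → sumL xs (λ x → f x * c) ≡ sumL xs f * c
sumL-*ʳ []       c f = refl
sumL-*ʳ (x ∷ xs) c f = trans (cong (f x * c +_) (sumL-*ʳ xs c f)) (sym (*-distribʳ-+ c (f x) _))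

sumL-const : ∀ {A : Set} (xs : List A) c → sumL xs (λ _ → c) ≡ length xs * c
sumL-const []       c = refl
sumL-const (x ∷ xs) c = cong (c +_) (sumL-const xs c)

sumL-replicate : ∀ {A : Set} c (a : A) f → sumL (replicate c a) f ≡ c * f a
sumL-replicate zero    a f = refl
sumL-replicate (suc c) a f = cong (f a +_) (sumL-replicate c a f)

length-concatMap : ∀ {A B : Set} (g : A → List B) xs → length (concatMap g xs) ≡ sumL xs (length ∘ g)
length-concatMap g []       = refl
length-concatMap g (x ∷ xs) = trans (length-++ (g x)) (cong (length (g x) +_) (length-concatMap g xs))

sumF : ∀ {N} → (Fin N → ℕ) → ℕ
sumF {zero}  f = 0
sumF {suc N} f = f zero + sumF (f ∘ suc)

prodF : ∀ {N} → (Fin N → ℕ) → ℕ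
prodF {zero}  f = 1
prodF {suc N} f = f zero * prodF (f ∘ suc)

sumL-tabulate : ∀ {A : Set} {N} (g : Fin N → A) f → sumL (List.tabulate g) f ≡ sumF (f ∘ g)
sumL-tabulate {N = zero}  g f = refl
sumL-tabulate {N = suc N} g f = cong (f (g zero) +_) (sumL-tabulate (g ∘ suc) f)

sumF-lookup : ∀ {A : Set} (xs : List A) (f : A → ℕ) → sumF (λ i → f (List.lookup xs i)) ≡ sumL xs f
sumF-lookup []       f = refl
sumF-lookup (x ∷ xs) f = cong (f x +_) (sumF-lookup xs f)

length-filterᵇ-tabulate : ∀ {A : Set} {N} (p : A → Bool) (g : Fin N → A) →
  length (filterᵇ p (List.tabulate g)) ≡ sumF (λ i → 𝟙 (p (g i)))
length-filterᵇ-tabulate {N = zero}  p g = refl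
length-filterᵇ-tabulate {N = suc N} p g with p (g zero)
... | true  = cong suc (length-filterᵇ-tabulate p (g ∘ suc))
... | false = length-filterᵇ-tabulate p (g ∘ suc)

sumF-cong : ∀ {N} {f g : Fin N → ℕ} → (∀ i → f i ≡ g i) → sumF f ≡ sumF g
sumF-cong {zero}  h = refl
sumF-cong {suc N} h = cong₂ _+_ (h zero) (sumF-cong (h ∘ suc))

prodF-cong : ∀ {N} {f g : Fin N → ℕ} → (∀ i → f i ≡ g i) → prodF f ≡ prodF g
prodF-cong {zero}  h = refl
prodF-cong {suc N} h = cong₂ _*_ (h zero) (prodF-cong (h ∘ suc))

sumF-+ : ∀ {N} (f g : Fin N → ℕ) → sumF (λ i → f i + g i) ≡ sumF f + sumF g
sumF-+ {zero}  f g = refl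
sumF-+ {suc N} f g rewrite sumF-+ (f ∘ suc) (g ∘ suc) =
  solve 4 (λ a b c d → (a :+ b) :+ (c :+ d) := (a :+ c) :+ (b :+ d)) refl (f zero) (g zero) (sumF (f ∘ suc)) (sumF (g ∘ suc))

sumF-*ˡ : ∀ {N} c (f : Fin N → ℕ) → sumF (λ i → c * f i) ≡ c * sumF f
sumF-*ˡ {zero}  c f = sym (*-zeroʳ c)
sumF-*ˡ {suc N} c f = trans (cong (c * f zero +_) (sumF-*ˡ c (f ∘ suc))) (sym (*-distribˡ-+ c (f zero) _))

sumF-zero : ∀ {N} (f : Fin N → ℕ) → (∀ i → f i ≡ 0) → sumF f ≡ 0
sumF-zero {zero}  f h = refl
sumF-zero {suc N} f h rewrite h zero = sumF-zero (f ∘ suc) (h ∘ suc)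

prodF-one : ∀ {N} (f : Fin N → ℕ) → (∀ i → f i ≡ 1) → prodF f ≡ 1
prodF-one {zero}  f h = refl
prodF-one {suc N} f h rewrite h zero | prodF-one (f ∘ suc) (h ∘ suc) = refl

sumF-ones : ∀ N → sumF {N} (λ _ → 1) ≡ N
sumF-ones zero    = refl
sumF-ones (suc N) = cong suc (sumF-ones N)

sumF-δ : ∀ {N} (i₀ : Fin N) (f : Fin N → ℕ) → sumF (λ i → if i ≡ᵇ i₀ then f i else 0) ≡ f i₀
sumF-δ {suc N} zero     f = trans (cong (f zero +_) (sumF-zero {N} _ (λ i → refl))) (+-identityʳ (f zero))
sumF-δ {suc N} (suc i₀) f = sumF-δ i₀ (f ∘ suc)

sumF-↑ : ∀ n {m} (f : Fin (n + m) → ℕ) → sumF f ≡ sumF (λ j → f (j ↑ˡ m)) + sumF (λ i → f (n ↑ʳ i))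
sumF-↑ zero    f = refl
sumF-↑ (suc n) f = trans (cong (f zero +_) (sumF-↑ n (f ∘ suc))) (sym (+-assoc (f zero) _ _))

prodF-↑ : ∀ n {m} (f : Fin (n + m) → ℕ) → prodF f ≡ prodF (λ j → f (j ↑ˡ m)) * prodF (λ i → f (n ↑ʳ i))
prodF-↑ zero    f = sym (+-identityʳ _)
prodF-↑ (suc n) f = trans (cong (f zero *_) (prodF-↑ n (f ∘ suc))) (sym (*-assoc (f zero) _ _))

sum-map-tabulate : ∀ {A : Set} {N} (g : Fin N → A) (f : A → ℕ) → sum (map f (List.tabulate g)) ≡ sumF (f ∘ g)
sum-map-tabulate {N = zero}  g f = refl
sum-map-tabulate {N = suc N} g f = cong (f (g zero) +_) (sum-map-tabulate (g ∘ suc) f)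

product-map-tabulate : ∀ {A : Set} {N} (g : Fin N → A) (f : A → ℕ) → product (map f (List.tabulate g)) ≡ prodF (f ∘ g)
product-map-tabulate {N = zero}  g f = refl
product-map-tabulate {N = suc N} g f = cong (f (g zero) *_) (product-map-tabulate (g ∘ suc) f)

count : ∀ {N} → (Fin N → Bool) → ℕ
count q = sumF (λ i → 𝟙 (q i))

𝟙-mono : ∀ a b → (a ≡ true → b ≡ true) → 𝟙 a ≤ 𝟙 b
𝟙-mono false b h = z≤n
𝟙-mono true  b h rewrite h refl = s≤s z≤n

count-mono : ∀ {N} (p q : Fin N → Bool) → (∀ i → p i ≡ true → q i ≡ true) → count p ≤ count q
count-mono {zero}  p q p⊆q = z≤n
count-mono {suc N} p q p⊆q = +-mono-≤ (𝟙-mono (p zero) (q zero) (p⊆q zero)) (count-mono (p ∘ suc) (q ∘ suc) (p⊆q ∘ suc))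

count-< : ∀ {N} (p q : Fin N → Bool) → (∀ i → p i ≡ true → q i ≡ true) →
          ∀ r → p r ≡ false → q r ≡ true → count p < count q
count-< {suc N} p q p⊆q zero pr qr rewrite pr | qr = s≤s (count-mono (p ∘ suc) (q ∘ suc) (p⊆q ∘ suc))
count-< {suc N} p q p⊆q (suc r) pr qr =
  subst (_≤ count q) (+-suc (𝟙 (p zero)) _)
    (+-mono-≤ (𝟙-mono (p zero) (q zero) (p⊆q zero)) (count-< (p ∘ suc) (q ∘ suc) (p⊆q ∘ suc) r pr qr))

count-pos : ∀ {N} (q : Fin N → Bool) r → q r ≡ true → 0 < count q
count-pos q r qr = ≤-trans (s≤s z≤n) (count-< (λ _ → false) q (λ _ ()) r refl qr)

count-empty : ∀ {N} (q : Fin N → Bool) → (∀ i → q i ≡ false) → count q ≡ 0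
count-empty q q≡false = sumF-zero _ (λ i → cong 𝟙 (q≡false i))

sumF-on-empty : ∀ {N} (q : Fin N → Bool) (x : Fin N → ℕ) → count q ≡ 0 → sumF (λ i → if q i then x i else 0) ≡ 0
sumF-on-empty {zero}  q x h = refl
sumF-on-empty {suc N} q x h with q zero
sumF-on-empty {suc N} q x () | true
... | false = sumF-on-empty (q ∘ suc) (x ∘ suc) h

prodF-on-empty : ∀ {N} (q : Fin N → Bool) (x : Fin N → ℕ) → count q ≡ 0 → prodF (λ i → if q i then x i else 1) ≡ 1
prodF-on-empty {zero}  q x h = refl
prodF-on-empty {suc N} q x h with q zero
prodF-on-empty {suc N} q x () | true
... | false rewrite prodF-on-empty (q ∘ suc) (x ∘ suc) h = refl

prodF-const-on : ∀ {N} (q : Fin N → Bool) y → prodF (λ i → if q i then y else 1) ≡ y ^ count q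
prodF-const-on {zero}  q y = refl
prodF-const-on {suc N} q y with q zero
... | true  rewrite prodF-const-on (q ∘ suc) y = refl
... | false rewrite prodF-const-on (q ∘ suc) y = +-identityʳ _

prodF-scale-on : ∀ {N} (q : Fin N → Bool) (x : Fin N → ℕ) y →
  prodF (λ i → if q i then y * x i else 1) ≡ prodF (λ i → if q i then x i else 1) * y ^ count q
prodF-scale-on {zero}  q x y = refl
prodF-scale-on {suc N} q x y with q zero
... | true rewrite prodF-scale-on (q ∘ suc) (x ∘ suc) y =
  solve 4 (λ a b c d → (a :* b) :* (c :* d) := (b :* c) :* (a :* d)) refl
    y (x zero) (prodF (λ i → if q (suc i) then x (suc i) else 1)) (y ^ count (q ∘ suc))
... | false rewrite prodF-scale-on (q ∘ suc) (x ∘ suc) y =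
  solve 2 (λ a b → a :* b :+ con 0 := (a :+ con 0) :* b) refl
    (prodF (λ i → if q (suc i) then x (suc i) else 1)) (y ^ count (q ∘ suc))

isZero : ℕ → ℕ
isZero zero    = 1
isZero (suc _) = 0

isZero-count : ∀ {N} (q : Fin N → Bool) → isZero (count q) ≡ prodF (λ i → 𝟙 (not (q i)))
isZero-count {zero}  q = refl
isZero-count {suc N} q with q zero
... | true  = refl
... | false rewrite sym (isZero-count (q ∘ suc)) = sym (+-identityʳ _)

sumL-allVecs-prodF : ∀ {A : Set} {N} (O : Fin N → List A) (g : Fin N → A → ℕ) →
  sumL (allVecs O) (λ ch → prodF (λ i → g i (lookup ch i))) ≡ prodF (λ i → sumL (O i) (g i))
sumL-allVecs-prodF {N = zero}  O g = refl
sumL-allVecs-prodF {A = A} {N = suc N} O g = begin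
  sumL (allVecs O) F
    ≡⟨ sumL-concatMap (λ a → map (a ∷_) rest) (O zero) F ⟩
  sumL (O zero) (λ a → sumL (map (a ∷_) rest) F)
    ≡⟨ sumL-cong (O zero) (λ a _ → trans (sumL-map (a ∷_) rest F) (sumL-*ˡ rest (g zero a) (F′ (g ∘ suc)))) ⟩
  sumL (O zero) (λ a → g zero a * sumL rest (F′ (g ∘ suc)))
    ≡⟨ sumL-*ʳ (O zero) _ (g zero) ⟩
  sumL (O zero) (g zero) * sumL rest (F′ (g ∘ suc))
    ≡⟨ cong (sumL (O zero) (g zero) *_) (sumL-allVecs-prodF (O ∘ suc) (g ∘ suc)) ⟩
  prodF (λ i → sumL (O i) (g i)) ∎
  where
  open ≡-Reasoning
  rest = allVecs (O ∘ suc)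
  F′ : ∀ {M} → (Fin M → A → ℕ) → Vec A M → ℕ
  F′ h ch = prodF (λ i → h i (lookup ch i))
  F = F′ g

-- sumProdExcept a c = Σᵢ c i · ∏_{j ≠ i} a j
sumProdExcept : ∀ {N} → (Fin N → ℕ) → (Fin N → ℕ) → ℕ
sumProdExcept {zero}  a c = 0
sumProdExcept {suc N} a c = a zero * sumProdExcept (a ∘ suc) (c ∘ suc) + c zero * prodF (a ∘ suc)

sumProdExcept-cong : ∀ {N} {a a′ c c′ : Fin N → ℕ} → (∀ i → a i ≡ a′ i) → (∀ i → c i ≡ c′ i) →
                     sumProdExcept a c ≡ sumProdExcept a′ c′
sumProdExcept-cong {zero}  ha hc = refl
sumProdExcept-cong {suc N} ha hc =
  cong₂ _+_ (cong₂ _*_ (ha zero) (sumProdExcept-cong (ha ∘ suc) (hc ∘ suc))) (cong₂ _*_ (hc zero) (prodF-cong (ha ∘ suc)))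

sumL-allVecs-prodF*sumF : ∀ {A : Set} {N} (O : Fin N → List A) (g h : Fin N → A → ℕ) →
  sumL (allVecs O) (λ ch → prodF (λ i → g i (lookup ch i)) * sumF (λ i → h i (lookup ch i)))
  ≡ sumProdExcept (λ i → sumL (O i) (g i)) (λ i → sumL (O i) (λ o → g i o * h i o))
sumL-allVecs-prodF*sumF {N = zero}  O g h = refl
sumL-allVecs-prodF*sumF {A = A} {N = suc N} O g h = begin
  sumL (allVecs O) F
    ≡⟨ sumL-concatMap (λ a → map (a ∷_) rest) (O zero) F ⟩
  sumL (O zero) (λ a → sumL (map (a ∷_) rest) F)
    ≡⟨ sumL-cong (O zero) (λ a _ → trans (sumL-map (a ∷_) rest F) (extend a)) ⟩
  sumL (O zero) (λ a → g zero a * E′ + g zero a * h zero a * P′)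
    ≡⟨ sumL-+ (O zero) (λ a → g zero a * E′) (λ a → g zero a * h zero a * P′) ⟩
  sumL (O zero) (λ a → g zero a * E′) + sumL (O zero) (λ a → g zero a * h zero a * P′)
    ≡⟨ cong₂ _+_ (sumL-*ʳ (O zero) E′ (g zero)) (sumL-*ʳ (O zero) P′ (λ a → g zero a * h zero a)) ⟩
  sumProdExcept (λ i → sumL (O i) (g i)) (λ i → sumL (O i) (λ o → g i o * h i o)) ∎
  where
  open ≡-Reasoning
  rest = allVecs (O ∘ suc)
  F : Vec A (suc N) → ℕ
  F ch = prodF (λ i → g i (lookup ch i)) * sumF (λ i → h i (lookup ch i))
  P Q : Vec A N → ℕ
  P ch = prodF (λ i → g (suc i) (lookup ch i))
  Q ch = sumF (λ i → h (suc i) (lookup ch i))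
  P′ = prodF (λ i → sumL (O (suc i)) (g (suc i)))
  E′ = sumProdExcept (λ i → sumL (O (suc i)) (g (suc i))) (λ i → sumL (O (suc i)) (λ o → g (suc i) o * h (suc i) o))
  extend : ∀ a → sumL rest (λ ch → F (a ∷ ch)) ≡ g zero a * E′ + g zero a * h zero a * P′
  extend a = begin
    sumL rest (λ ch → F (a ∷ ch))
      ≡⟨ sumL-cong rest (λ ch _ → solve 4 (λ x y p q → x :* p :* (y :+ q) := x :* (p :* q) :+ x :* y :* p) refl
                                          (g zero a) (h zero a) (P ch) (Q ch)) ⟩
    sumL rest (λ ch → g zero a * (P ch * Q ch) + g zero a * h zero a * P ch)
      ≡⟨ sumL-+ rest (λ ch → g zero a * (P ch * Q ch)) (λ ch → g zero a * h zero a * P ch) ⟩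
    sumL rest (λ ch → g zero a * (P ch * Q ch)) + sumL rest (λ ch → g zero a * h zero a * P ch)
      ≡⟨ cong₂ _+_ (sumL-*ˡ rest (g zero a) (λ ch → P ch * Q ch)) (sumL-*ˡ rest (g zero a * h zero a) P) ⟩
    g zero a * sumL rest (λ ch → P ch * Q ch) + g zero a * h zero a * sumL rest P
      ≡⟨ cong₂ (λ x y → g zero a * x + g zero a * h zero a * y)
               (sumL-allVecs-prodF*sumF (O ∘ suc) (g ∘ suc) (h ∘ suc)) (sumL-allVecs-prodF (O ∘ suc) (g ∘ suc)) ⟩
    g zero a * E′ + g zero a * h zero a * P′ ∎

sumProdExcept-closed : ∀ {N} (q : Fin N → Bool) (x : Fin N → ℕ) (s t : ℕ) →
  sumProdExcept (λ i → if q i then s * x i else 1) (λ i → if q i then t * x i * x i else 0)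
  ≡ t * sumF (λ i → if q i then x i else 0) * prodF (λ i → if q i then x i else 1) * s ^ (count q ∸ 1)
sumProdExcept-closed {zero} q x s t = cong (λ z → z * 1 * 1) (sym (*-zeroʳ t))
sumProdExcept-closed {suc N} q x s t with q zero
... | false rewrite sumProdExcept-closed (q ∘ suc) (x ∘ suc) s t =
  solve 4 (λ a b c d → a :* b :* c :* d :+ con 0 :+ con 0 := a :* b :* (c :+ con 0) :* d) refl t X Π (s ^ (count (q ∘ suc) ∸ 1))
  where
  X = sumF (λ i → if q (suc i) then x (suc i) else 0)
  Π = prodF (λ i → if q (suc i) then x (suc i) else 1)
... | true rewrite sumProdExcept-closed (q ∘ suc) (x ∘ suc) s t | prodF-scale-on (q ∘ suc) (x ∘ suc) s =
  extend (count (q ∘ suc)) refl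
  where
  X = sumF (λ i → if q (suc i) then x (suc i) else 0)
  Π = prodF (λ i → if q (suc i) then x (suc i) else 1)
  x₀ = x zero
  extend : ∀ M → M ≡ count (q ∘ suc) →
           s * x₀ * (t * X * Π * s ^ (M ∸ 1)) + t * x₀ * x₀ * (Π * s ^ M) ≡ t * (x₀ + X) * (x₀ * Π) * s ^ M
  extend zero eq rewrite sumF-on-empty (q ∘ suc) (x ∘ suc) (sym eq) =
    solve 4 (λ s x₀ t Π → s :* x₀ :* (t :* con 0 :* Π :* con 1) :+ t :* x₀ :* x₀ :* (Π :* con 1)
                          := t :* (x₀ :+ con 0) :* (x₀ :* Π) :* con 1) refl s x₀ t Π
  extend (suc M) eq =
    solve 6 (λ s x₀ t Π X sM → s :* x₀ :* (t :* X :* Π :* sM) :+ t :* x₀ :* x₀ :* (Π :* (s :* sM))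
                               := t :* (x₀ :+ X) :* (x₀ :* Π) :* (s :* sM)) refl s x₀ t Π X (s ^ M)

module RootedForests (G : Multigraph) (loopless : ∀ e → proj₁ (ends G e) ≢ proj₂ (ends G e)) where

  Vertex = Fin (V G)
  Edge = Fin (E G)
  VertexSet = Vertex → Bool
  EdgeSet = Sub.Subset (E G)
  Choice = Vec (Maybe Edge) (V G)

  open DecMembership (Fin._≟_ {n = E G}) using (_∈?_)

  src tgt : Edge → Vertex
  src e = proj₁ (ends G e)
  tgt e = proj₂ (ends G e)

  ∈⇒lookup : ∀ {S : EdgeSet} {e} → e Sub.∈ S → lookup S e ≡ true
  ∈⇒lookup = []=⇒lookup

  lookup⇒∈ : ∀ {S : EdgeSet} {e} → lookup S e ≡ true → e Sub.∈ S
  lookup⇒∈ {S} {e} = lookup⇒[]= e S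

  joins-ends : ∀ {e x y} → Joins G e x y → (src e ≡ x × tgt e ≡ y) ⊎ (src e ≡ y × tgt e ≡ x)
  joins-ends (inj₁ eq) = inj₁ (cong proj₁ eq , cong proj₂ eq)
  joins-ends (inj₂ eq) = inj₂ (cong proj₁ eq , cong proj₂ eq)

  joins-src-tgt : ∀ e → Joins G e (src e) (tgt e)
  joins-src-tgt e = inj₁ refl

  joins-sym : ∀ {e x y} → Joins G e x y → Joins G e y x
  joins-sym (inj₁ p) = inj₂ p
  joins-sym (inj₂ p) = inj₁ p

  joins-same : ∀ {e x y a b} → Joins G e x y → Joins G e a b → (x ≡ a × y ≡ b) ⊎ (x ≡ b × y ≡ a)
  joins-same j k with joins-ends j | joins-ends k
  ... | inj₁ (p , q) | inj₁ (r , s) = inj₁ (trans (sym p) r , trans (sym q) s)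
  ... | inj₁ (p , q) | inj₂ (r , s) = inj₂ (trans (sym p) r , trans (sym q) s)
  ... | inj₂ (p , q) | inj₁ (r , s) = inj₂ (trans (sym q) s , trans (sym p) r)
  ... | inj₂ (p , q) | inj₂ (r , s) = inj₁ (trans (sym q) s , trans (sym p) r)

  joins-endpoint : ∀ {e x y} → Joins G e x y → x ≡ src e ⊎ x ≡ tgt e
  joins-endpoint j with joins-ends j
  ... | inj₁ (p , _) = inj₁ (sym p)
  ... | inj₂ (_ , q) = inj₂ (sym q)

  joins-both : ∀ {e x y} (P : Vertex → Set) → P (src e) → P (tgt e) → Joins G e x y → P x × P y
  joins-both P ps pt j with joins-ends j
  ... | inj₁ (refl , refl) = ps , pt
  ... | inj₂ (refl , refl) = pt , ps

  joins-ends-both : ∀ {e x y} (P : Vertex → Set) → Joins G e x y → P x → P y → P (src e) × P (tgt e)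
  joins-ends-both P j px py with joins-ends j
  ... | inj₁ (refl , refl) = px , py
  ... | inj₂ (refl , refl) = py , px

  joins-distinct : ∀ {e x y} → Joins G e x y → x ≢ y
  joins-distinct {e} j refl with joins-ends j
  ... | inj₁ (p , q) = loopless e (trans p (sym q))
  ... | inj₂ (p , q) = loopless e (trans p (sym q))

  walk-edges : ∀ {S x y es} → Walk G S x y es → All (λ e → lookup S e ≡ true) es
  walk-edges stop           = []
  walk-edges (step e m j w) = ∈⇒lookup m ∷ walk-edges w

  walk-restrict : ∀ {S S′ x y es} → Walk G S x y es → All (λ e → lookup S′ e ≡ true) es → Walk G S′ x y es
  walk-restrict stop           []       = stop
  walk-restrict (step e m j w) (p ∷ ps) = step e (lookup⇒∈ p) j (walk-restrict w ps)

  walk-mono : ∀ {S S′ x y es} → (∀ e → lookup S e ≡ true → lookup S′ e ≡ true) → Walk G S x y es → Walk G S′ x y es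
  walk-mono S⊆S′ w = walk-restrict w (All.map (λ {e} → S⊆S′ e) (walk-edges w))

  _++ʷ_ : ∀ {S x y z es fs} → Walk G S x y es → Walk G S y z fs → Walk G S x z (es ++ fs)
  stop         ++ʷ w = w
  step e m j v ++ʷ w = step e m j (v ++ʷ w)

  splitWalk : ∀ {S x z} es {fs} → Walk G S x z (es ++ fs) → ∃ λ y → Walk G S x y es × Walk G S y z fs
  splitWalk []       w = _ , stop , w
  splitWalk (e ∷ es) (step .e m j w) with splitWalk es w
  ... | y , w₁ , w₂ = y , step e m j w₁ , w₂

  reverseWalk : ∀ {S x y es} → Walk G S x y es → ∃ λ es′ → Walk G S y x es′
  reverseWalk stop = [] , stop
  reverseWalk (step e m j w) with reverseWalk w
  ... | es′ , w′ = es′ ++ [ e ] , w′ ++ʷ step e m (joins-sym j) stop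

  trail-shortcut : ∀ {S x w y e} pre post → Joins G e x w → Walk G S w y (pre ++ e ∷ post) → Unique (pre ++ e ∷ post) →
                   ∃ λ es → Walk G S x y es × Unique es
  trail-shortcut {e = e} pre post j w u with splitWalk pre w
  ... | _ , _ , step .e m′ j′ rest with joins-same j j′ | unique-++⁻ʳ pre u
  ... | inj₁ (refl , refl) | u′     = e ∷ post , step e m′ j′ rest , u′
  ... | inj₂ (refl , refl) | _ ∷ u′ = post , rest , u′

  walk⇒trail : ∀ {S x y es} → Walk G S x y es → ∃ λ es′ → Walk G S x y es′ × Unique es′
  walk⇒trail stop = [] , stop , []
  walk⇒trail {S} {y = y} (step e m j w) with walk⇒trail w
  ... | ts , tw , tu with e ∈? ts
  ... | no e∉ = e ∷ ts , step e m j tw , All.tabulate (λ z∈ eq → e∉ (subst (_∈ ts) (sym eq) z∈)) ∷ tu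
  ... | yes e∈ with ∈-∃++ e∈
  ... | pre , post , refl = trail-shortcut pre post j tw tu

  record IsForest (W R : VertexSet) (S : EdgeSet) : Set where
    field
      edges-inside : ∀ e → lookup S e ≡ true → W (src e) ≡ true × W (tgt e) ≡ true
      acyclic      : ¬ HasCycle G S
      reaches-root : ∀ v → W v ≡ true → ∃ λ ρ → R ρ ≡ true × ∃ λ es → Walk G S v ρ es
      roots-apart  : ∀ ρ₁ ρ₂ → R ρ₁ ≡ true → R ρ₂ ≡ true → (∃ λ es → Walk G S ρ₁ ρ₂ es) → ρ₁ ≡ ρ₂

  record Enumeration (W R : VertexSet) : Set where
    field
      forests  : List EdgeSet
      unique   : Unique forests
      sound    : ∀ S → S ∈ forests → IsForest W R S
      complete : ∀ S → IsForest W R S → S ∈ forests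

  _∖_ : VertexSet → VertexSet → VertexSet
  (W ∖ R) v = W v ∧ not (R v)

  ∖-elim : ∀ {W R v} → (W ∖ R) v ≡ true → W v ≡ true × R v ≡ false
  ∖-elim {W} {R} {v} h with W v | R v
  ... | true | false = refl , refl

  ∖-intro : ∀ {W R v} → W v ≡ true → R v ≡ false → (W ∖ R) v ≡ true
  ∖-intro p q rewrite p | q = refl

  ∖-disjoint : ∀ {W R v} → (W ∖ R) v ≡ true → R v ≡ true → ⊥
  ∖-disjoint {W} {R} {v} u r = false≢true (trans (sym (proj₂ (∖-elim {W} {R} {v} u))) r)

  joinsTo : VertexSet → Vertex → Edge → Bool
  joinsTo R v e = (src e ≡ᵇ v ∧ R (tgt e)) ∨ (tgt e ≡ᵇ v ∧ R (src e))

  joinsTo-sound : ∀ {R v e} → joinsTo R v e ≡ true → ∃ λ ρ → R ρ ≡ true × Joins G e v ρ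
  joinsTo-sound {R} {v} {e} h with ∨-true⁻ {src e ≡ᵇ v ∧ R (tgt e)} h
  ... | inj₁ a = let p , q = ∧-true⁻ a in tgt e , q , subst (λ x → Joins G e x (tgt e)) (≡ᵇ⇒≡ p) (joins-src-tgt e)
  ... | inj₂ b = let p , q = ∧-true⁻ b in src e , q , subst (λ x → Joins G e x (src e)) (≡ᵇ⇒≡ p) (joins-sym (joins-src-tgt e))

  joinsTo-complete : ∀ {R v e ρ} → Joins G e v ρ → R ρ ≡ true → joinsTo R v e ≡ true
  joinsTo-complete {R} {v} {e} j r with joins-ends j
  ... | inj₁ (refl , refl) rewrite ≡ᵇ-refl (src e) | r = refl
  ... | inj₂ (refl , refl) rewrite ≡ᵇ-refl (tgt e) | r = ∨-true⁺ʳ (src e ≡ᵇ tgt e ∧ R (tgt e)) refl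

  -- A vertex of W ∖ R picks nothing or an edge joining it to R; the picking vertices are the next roots.
  options : VertexSet → VertexSet → Vertex → List (Maybe Edge)
  options W R v = if (W ∖ R) v then nothing ∷ map just (filterᵇ (joinsTo R v) (allFin (E G))) else nothing ∷ []

  ValidOption : VertexSet → VertexSet → Vertex → Maybe Edge → Set
  ValidOption W R v o = o ≡ nothing ⊎ ∃ λ e → o ≡ just e × (W ∖ R) v ≡ true × joinsTo R v e ≡ true

  ValidChoice : VertexSet → VertexSet → Choice → Set
  ValidChoice W R ch = ∀ v → ValidOption W R v (lookup ch v)

  ∈-options⁻ : ∀ W R v {o} → o ∈ options W R v → ValidOption W R v o
  ∈-options⁻ W R v o∈ with (W ∖ R) v
  ∈-options⁻ W R v (here refl) | true = inj₁ refl
  ∈-options⁻ W R v (there o∈) | true with ∈-map⁻ just o∈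
  ... | e , e∈ , refl = inj₂ (e , refl , refl , proj₂ (∈-filterᵇ⁻ (joinsTo R v) (allFin (E G)) e∈))
  ∈-options⁻ W R v (here refl) | false = inj₁ refl

  ∈-options⁺ : ∀ W R v o → ValidOption W R v o → o ∈ options W R v
  ∈-options⁺ W R v o (inj₁ refl) with (W ∖ R) v
  ... | true  = here refl
  ... | false = here refl
  ∈-options⁺ W R v o (inj₂ (e , refl , uv , jt)) rewrite uv =
    there (∈-map⁺ just (∈-filterᵇ⁺ (joinsTo R v) (∈-allFin e) jt))

  options-unique : ∀ W R v → Unique (options W R v)
  options-unique W R v with (W ∖ R) v
  ... | true  = All.tabulate nothing∉ ∷ map⁺ just-injective (filter⁺ (T? ∘ joinsTo R v) (allFin⁺ (E G)))
    where
    nothing∉ : ∀ {z} → z ∈ map just (filterᵇ (joinsTo R v) (allFin (E G))) → nothing ≢ z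
    nothing∉ z∈ eq with ∈-map⁻ just z∈
    nothing∉ z∈ () | _ , _ , refl
  ... | false = [] ∷ []

  ∈-allVecs⇒valid : ∀ W R {ch} → ch ∈ allVecs (options W R) → ValidChoice W R ch
  ∈-allVecs⇒valid W R ch∈ v = ∈-options⁻ W R v (∈-allVecs⁻ (options W R) ch∈ v)

  isJust : Maybe Edge → Edge → Bool
  isJust nothing   e = false
  isJust (just e′) e = e′ ≡ᵇ e

  isJust-true : ∀ {o e} → isJust o e ≡ true → o ≡ just e
  isJust-true {just e′} h = cong just (≡ᵇ⇒≡ h)

  picks : Choice → Edge → Bool
  picks ch e = isJust (lookup ch (src e)) e ∨ isJust (lookup ch (tgt e)) e

  picks-sound : ∀ {ch e} → picks ch e ≡ true → ∃ λ w → lookup ch w ≡ just e × (w ≡ src e ⊎ w ≡ tgt e)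
  picks-sound {ch} {e} h with ∨-true⁻ {isJust (lookup ch (src e)) e} h
  ... | inj₁ a = src e , isJust-true a , inj₁ refl
  ... | inj₂ b = tgt e , isJust-true b , inj₂ refl

  picks-intro : ∀ {ch e w} → lookup ch w ≡ just e → w ≡ src e ⊎ w ≡ tgt e → picks ch e ≡ true
  picks-intro {ch} {e} eq (inj₁ refl) rewrite eq = ∨-true⁺ˡ (isJust (lookup ch (tgt e)) e) (≡ᵇ-refl e)
  picks-intro {ch} {e} eq (inj₂ refl) rewrite eq = ∨-true⁺ʳ (isJust (lookup ch (src e)) e) (≡ᵇ-refl e)

  addPicked : Choice → EdgeSet → EdgeSet
  addPicked ch S′ = tabulate (λ e → lookup S′ e ∨ picks ch e)

  addPicked-lookup : ∀ ch S′ e → lookup (addPicked ch S′) e ≡ (lookup S′ e ∨ picks ch e)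
  addPicked-lookup ch S′ e = lookup∘tabulate (λ e → lookup S′ e ∨ picks ch e) e

  nextRoots : VertexSet → VertexSet → Choice → VertexSet
  nextRoots W R ch v = is-just (lookup ch v) ∧ (W ∖ R) v

  nextRoots⊆∖ : ∀ W R ch v → nextRoots W R ch v ≡ true → (W ∖ R) v ≡ true
  nextRoots⊆∖ W R ch v h = proj₂ (∧-true⁻ {is-just (lookup ch v)} h)

  nextRoots-just : ∀ {W R ch v} → nextRoots W R ch v ≡ true → ∃ λ e → lookup ch v ≡ just e
  nextRoots-just {W} {R} {ch} {v} h with lookup ch v
  ... | just e = e , refl

  nextRoots-intro : ∀ {W R ch v e} → ValidChoice W R ch → lookup ch v ≡ just e → nextRoots W R ch v ≡ true
  nextRoots-intro {ch = ch} {v} valid eq with valid v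
  ... | inj₁ none rewrite eq = case none of λ ()
  ... | inj₂ (e , eq′ , uv , _) rewrite eq′ | uv = refl

  picked-edge : ∀ {W R ch w e} → ValidChoice W R ch → lookup ch w ≡ just e →
                (W ∖ R) w ≡ true × ∃ λ ρ → R ρ ≡ true × Joins G e w ρ
  picked-edge {ch = ch} {w} valid eq with valid w
  ... | inj₁ none rewrite eq = case none of λ ()
  ... | inj₂ (e′ , eq′ , uv , jt) with trans (sym eq) eq′
  ... | refl = uv , joinsTo-sound jt

  module Assemble (W R : VertexSet) (R⊆W : ∀ v → R v ≡ true → W v ≡ true)
                  (ch : Choice) (valid : ValidChoice W R ch)
                  (S′ : EdgeSet) (F′ : IsForest (W ∖ R) (nextRoots W R ch) S′) where

    S : EdgeSet
    S = addPicked ch S′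

    ∖-not-root : ∀ {x} → (W ∖ R) x ≡ true → R x ≡ true → ⊥
    ∖-not-root {x} = ∖-disjoint {W} {R} {x}

    SubChoice : Choice → Set
    SubChoice ch′ = ∀ v e → lookup ch′ v ≡ just e → lookup ch v ≡ just e

    -- Invariant along the edges of addPicked ch′ S′: x is the root ρ itself, or reaches through S′
    -- a vertex c whose pick in ch′ leads to ρ.
    RootedAt : Choice → Vertex → Vertex → Set
    RootedAt ch′ x ρ = (R x ≡ true × x ≡ ρ) ⊎
      ((W ∖ R) x ≡ true × ∃ λ c → ∃ λ e → lookup ch′ c ≡ just e × Joins G e c ρ × R ρ ≡ true × ∃ λ es → Walk G S′ x c es)

    rootedAt-pick-forward : ∀ ch′ → SubChoice ch′ → ∀ {e w ρ ρ′} → lookup ch′ w ≡ just e → (W ∖ R) w ≡ true →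
                            R ρ′ ≡ true → Joins G e w ρ′ → RootedAt ch′ w ρ → RootedAt ch′ ρ′ ρ
    rootedAt-pick-forward ch′ sub eqw uw rρ′ J (inj₁ (rw , _)) = ⊥-elim (∖-not-root uw rw)
    rootedAt-pick-forward ch′ sub {e} {w} eqw uw rρ′ J (inj₂ (_ , c , e′ , eqc , Jc , rρ , es , wk))
      with IsForest.roots-apart F′ w c (nextRoots-intro {W} {R} {ch} valid (sub w e eqw))
                                       (nextRoots-intro {W} {R} {ch} valid (sub c e′ eqc)) (es , wk)
    ... | refl with just-injective (trans (sym eqw) eqc)
    ... | refl with joins-same Jc J
    ... | inj₁ (_ , ρ≡ρ′) = inj₁ (rρ′ , sym ρ≡ρ′)
    ... | inj₂ (w≡ρ′ , _) = ⊥-elim (∖-not-root uw (subst (λ z → R z ≡ true) (sym w≡ρ′) rρ′))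

    rootedAt-pick-backward : ∀ ch′ → ∀ {e w ρ ρ′} → lookup ch′ w ≡ just e → (W ∖ R) w ≡ true → R ρ′ ≡ true →
                             Joins G e w ρ′ → RootedAt ch′ ρ′ ρ → RootedAt ch′ w ρ
    rootedAt-pick-backward ch′ eqw uw rρ′ J (inj₁ (_ , refl)) = inj₂ (uw , _ , _ , eqw , J , rρ′ , [] , stop)
    rootedAt-pick-backward ch′ eqw uw rρ′ J (inj₂ (uρ′ , _)) = ⊥-elim (∖-not-root uρ′ rρ′)

    rootedAt-step : ∀ ch′ → SubChoice ch′ → ∀ {e x y ρ} → lookup (addPicked ch′ S′) e ≡ true → Joins G e x y →
                    RootedAt ch′ x ρ → RootedAt ch′ y ρ
    rootedAt-step ch′ sub {e} {x} {y} {ρ} m j L with ∨-true⁻ {lookup S′ e} (trans (sym (addPicked-lookup ch′ S′ e)) m)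
    ... | inj₁ s′e = along-S′ L
      where
      uxy : (W ∖ R) x ≡ true × (W ∖ R) y ≡ true
      uxy = let us , ut = IsForest.edges-inside F′ e s′e in joins-both (λ v → (W ∖ R) v ≡ true) us ut j
      along-S′ : RootedAt ch′ x ρ → RootedAt ch′ y ρ
      along-S′ (inj₁ (rx , _)) = ⊥-elim (∖-not-root (proj₁ uxy) rx)
      along-S′ (inj₂ (_ , c , e′ , eq , J , rρ , es , wk)) =
        inj₂ (proj₂ uxy , c , e′ , eq , J , rρ , e ∷ es , step e (lookup⇒∈ s′e) (joins-sym j) wk)
    ... | inj₂ h with picks-sound {ch′} h
    ... | w , eqw , _ with picked-edge {W} {R} {ch} valid (sub w e eqw)
    ... | uw , ρ′ , rρ′ , J with joins-same j J
    ... | inj₁ (refl , refl) = rootedAt-pick-forward ch′ sub eqw uw rρ′ J L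
    ... | inj₂ (refl , refl) = rootedAt-pick-backward ch′ eqw uw rρ′ J L

    rootedAt-walk : ∀ ch′ → SubChoice ch′ → ∀ {x y es ρ} → Walk G (addPicked ch′ S′) x y es →
                    RootedAt ch′ x ρ → RootedAt ch′ y ρ
    rootedAt-walk ch′ sub stop           L = L
    rootedAt-walk ch′ sub (step e m j w) L = rootedAt-walk ch′ sub w (rootedAt-step ch′ sub (∈⇒lookup m) j L)

    rootedAt-walk⁻ : ∀ ch′ → SubChoice ch′ → ∀ {x y es ρ} → Walk G (addPicked ch′ S′) x y es →
                     RootedAt ch′ y ρ → RootedAt ch′ x ρ
    rootedAt-walk⁻ ch′ sub stop           L = L
    rootedAt-walk⁻ ch′ sub (step e m j w) L = rootedAt-step ch′ sub (∈⇒lookup m) (joins-sym j) (rootedAt-walk⁻ ch′ sub w L)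

    edges-inside : ∀ e → lookup S e ≡ true → W (src e) ≡ true × W (tgt e) ≡ true
    edges-inside e m with ∨-true⁻ {lookup S′ e} (trans (sym (addPicked-lookup ch S′ e)) m)
    ... | inj₁ s′e = let us , ut = IsForest.edges-inside F′ e s′e in proj₁ (∖-elim {W} {R} us) , proj₁ (∖-elim {W} {R} ut)
    ... | inj₂ h with picks-sound {ch} h
    ... | w , eqw , _ with picked-edge {W} {R} {ch} valid eqw
    ... | uw , ρ , rρ , J = joins-ends-both (λ z → W z ≡ true) J (proj₁ (∖-elim {W} {R} uw)) (R⊆W ρ rρ)

    S′⊆S : ∀ e → lookup S′ e ≡ true → lookup S e ≡ true
    S′⊆S e h = trans (addPicked-lookup ch S′ e) (∨-true⁺ˡ (picks ch e) h)

    reaches-root : ∀ v → W v ≡ true → ∃ λ ρ → R ρ ≡ true × ∃ λ es → Walk G S v ρ es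
    reaches-root v wv with R v in rv
    ... | true  = v , rv , [] , stop
    ... | false with IsForest.reaches-root F′ v (∖-intro {W} {R} wv rv)
    ... | c , cc , es , wk with nextRoots-just {W} {R} {ch} cc
    ... | e , eqc with picked-edge {W} {R} {ch} valid eqc
    ... | _ , ρ , rρ , J =
      ρ , rρ , es ++ [ e ] , walk-mono S′⊆S wk ++ʷ step e (lookup⇒∈ e∈S) J stop
      where
      e∈S : lookup S e ≡ true
      e∈S = trans (addPicked-lookup ch S′ e) (∨-true⁺ʳ (lookup S′ e) (picks-intro {ch} eqc (joins-endpoint J)))

    roots-apart : ∀ ρ₁ ρ₂ → R ρ₁ ≡ true → R ρ₂ ≡ true → (∃ λ es → Walk G S ρ₁ ρ₂ es) → ρ₁ ≡ ρ₂
    roots-apart ρ₁ ρ₂ r₁ r₂ (es , wk) with rootedAt-walk ch (λ _ _ h → h) wk (inj₁ (r₁ , refl))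
    ... | inj₁ (_ , eq) = sym eq
    ... | inj₂ (u₂ , _) = ⊥-elim (∖-not-root u₂ r₂)

    unpick : Vertex → Choice
    unpick w = tabulate (λ v → if v ≡ᵇ w then nothing else lookup ch v)

    unpick-lookup : ∀ w v → lookup (unpick w) v ≡ (if v ≡ᵇ w then nothing else lookup ch v)
    unpick-lookup w v = lookup∘tabulate (λ v → if v ≡ᵇ w then nothing else lookup ch v) v

    unpick-sub : ∀ w → SubChoice (unpick w)
    unpick-sub w v e h with v ≡ᵇ w | unpick-lookup w v
    ... | true  | eq = case trans (sym h) eq of λ ()
    ... | false | eq = trans (sym eq) h

    unpick-self : ∀ w → lookup (unpick w) w ≡ nothing
    unpick-self w = trans (unpick-lookup w w) (cong (λ b → if b then nothing else lookup ch w) (≡ᵇ-refl w))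

    unpick-other : ∀ w v → v ≢ w → lookup (unpick w) v ≡ lookup ch v
    unpick-other w v v≢w = trans (unpick-lookup w v) (cong (λ b → if b then nothing else lookup ch v) (≢⇒≡ᵇ-false v≢w))

    unpick-keeps : ∀ {w f g} → lookup ch w ≡ just f → lookup S g ≡ true → g ≢ f → lookup (addPicked (unpick w) S′) g ≡ true
    unpick-keeps {w} {f} {g} eqw sg g≢f with ∨-true⁻ {lookup S′ g} (trans (sym (addPicked-lookup ch S′ g)) sg)
    ... | inj₁ s′g = trans (addPicked-lookup (unpick w) S′ g) (∨-true⁺ˡ (picks (unpick w) g) s′g)
    ... | inj₂ pg with picks-sound {ch} pg
    ... | w′ , eqw′ , end with w′ Fin.≟ w
    ... | yes refl = ⊥-elim (g≢f (just-injective (trans (sym eqw′) eqw)))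
    ... | no w′≢w  = trans (addPicked-lookup (unpick w) S′ g)
                           (∨-true⁺ʳ (lookup S′ g) (picks-intro {unpick w} (trans (unpick-other w w′ w′≢w) eqw′) end))

    unpicked-not-rooted : ∀ {w ρ f} → lookup ch w ≡ just f → ¬ RootedAt (unpick w) w ρ
    unpicked-not-rooted {w} eqw (inj₁ (rw , _)) = ∖-not-root (proj₁ (picked-edge {W} {R} {ch} valid eqw)) rw
    unpicked-not-rooted {w} eqw (inj₂ (uw , c , e , eqc , _ , _ , es , wk))
      with IsForest.roots-apart F′ w c (nextRoots-intro {W} {R} {ch} valid eqw)
                                       (nextRoots-intro {W} {R} {ch} valid (unpick-sub w c e eqc)) (es , wk)
    ... | refl = case trans (sym eqc) (unpick-self w) of λ ()

    -- Without w's pick f, the rest of a cycle through f would still connect w to the root at the other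
    -- end of f, but w can then no longer be rooted.
    picked-not-on-cycle : ∀ {a b f es} → picks ch f ≡ true → Joins G f a b → Walk G S b a es → All (_≢ f) es → ⊥
    picked-not-on-cycle {a} {b} {f} {es} pf Jab wk f∉ with picks-sound {ch} pf
    ... | w , eqw , _ with picked-edge {W} {R} {ch} valid eqw
    ... | _ , ρ , rρ , J = by-orientation (joins-same Jab J)
      where
      wk₋ : Walk G (addPicked (unpick w) S′) b a es
      wk₋ = walk-restrict wk (All.zipWith (λ (sg , g≢f) → unpick-keeps eqw sg g≢f) (walk-edges wk , f∉))
      by-orientation : (a ≡ w × b ≡ ρ) ⊎ (a ≡ ρ × b ≡ w) → ⊥
      by-orientation (inj₁ (refl , refl)) = unpicked-not-rooted eqw (rootedAt-walk (unpick w) (unpick-sub w) wk₋ (inj₁ (rρ , refl)))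
      by-orientation (inj₂ (refl , refl)) = unpicked-not-rooted eqw (rootedAt-walk⁻ (unpick w) (unpick-sub w) wk₋ (inj₁ (rρ , refl)))

    no-picked-cycle : ∀ {u f cyc} → Walk G S u u cyc → Unique cyc → f ∈ cyc → picks ch f ≡ true → ⊥
    no-picked-cycle wk u! f∈ pf with ∈-∃++ f∈
    ... | pre , post , refl with splitWalk pre wk
    ... | _ , w₁ , step _ m j rest = picked-not-on-cycle pf j (rest ++ʷ w₁) (unique-rotate-∉ pre u!)

    acyclic : ¬ HasCycle G S
    acyclic (u , e₀ , es , wk , u!) with any? (λ f → picks ch f Bool.≟ true) (e₀ ∷ es)
    ... | yes picked = let f , f∈ , pf = find picked in no-picked-cycle wk u! f∈ pf
    ... | no ¬picked =
      IsForest.acyclic F′ (u , e₀ , es , walk-restrict wk (All.zipWith (λ (sg , ¬pg) → only-S′ sg (¬-not ¬pg))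
                                                                      (walk-edges wk , ¬Any⇒All¬ _ ¬picked)) , u!)
      where
      only-S′ : ∀ {g} → lookup S g ≡ true → picks ch g ≡ false → lookup S′ g ≡ true
      only-S′ {g} sg ¬pg with ∨-true⁻ {lookup S′ g} (trans (sym (addPicked-lookup ch S′ g)) sg)
      ... | inj₁ s′g = s′g
      ... | inj₂ pg  = ⊥-elim (false≢true (trans (sym ¬pg) pg))

    forest : IsForest W R S
    forest = record { edges-inside = edges-inside ; acyclic = acyclic ; reaches-root = reaches-root ; roots-apart = roots-apart }

  module Decompose (W R : VertexSet) (S : EdgeSet) (F : IsForest W R S) where

    linksToRoot : Vertex → Edge → Bool
    linksToRoot v e = lookup S e ∧ joinsTo R v e

    choiceOf : Choice
    choiceOf = tabulate (λ v → if (W ∖ R) v then search (linksToRoot v) else nothing)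

    choiceOf-lookup : ∀ v → lookup choiceOf v ≡ (if (W ∖ R) v then search (linksToRoot v) else nothing)
    choiceOf-lookup v = lookup∘tabulate (λ v → if (W ∖ R) v then search (linksToRoot v) else nothing) v

    choiceOf-∖ : ∀ v → (W ∖ R) v ≡ true → lookup choiceOf v ≡ search (linksToRoot v)
    choiceOf-∖ v uv = trans (choiceOf-lookup v) (cong (λ b → if b then search (linksToRoot v) else nothing) uv)

    choiceOf-outside : ∀ v → (W ∖ R) v ≡ false → lookup choiceOf v ≡ nothing
    choiceOf-outside v uv = trans (choiceOf-lookup v) (cong (λ b → if b then search (linksToRoot v) else nothing) uv)

    choiceOf-just : ∀ {v e} → lookup choiceOf v ≡ just e → lookup S e ≡ true
    choiceOf-just {v} {e} eq with bool-cases ((W ∖ R) v)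
    ... | inj₁ uv  = proj₁ (∧-true⁻ (search-just (linksToRoot v) (trans (sym (choiceOf-∖ v uv)) eq)))
    ... | inj₂ ¬uv = case trans (sym eq) (choiceOf-outside v ¬uv) of λ ()

    choiceOf-valid : ValidChoice W R choiceOf
    choiceOf-valid v with bool-cases ((W ∖ R) v)
    ... | inj₂ ¬uv = inj₁ (choiceOf-outside v ¬uv)
    ... | inj₁ uv with search (linksToRoot v) in s
    ... | nothing = inj₁ (trans (choiceOf-∖ v uv) s)
    ... | just e  = inj₂ (e , trans (choiceOf-∖ v uv) s , uv , proj₂ (∧-true⁻ (search-just (linksToRoot v) s)))

    -- Two distinct forest edges from u to roots would close a cycle (same root) or join two roots.
    choiceOf-forced : ∀ {u e} → lookup S e ≡ true → joinsTo R u e ≡ true → (W ∖ R) u ≡ true → lookup choiceOf u ≡ just e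
    choiceOf-forced {u} {e} se jt uu with search (linksToRoot u) in s
    ... | nothing = ⊥-elim (false≢true (trans (sym (search-nothing (linksToRoot u) s e)) (trans (cong (_∧ joinsTo R u e) se) jt)))
    ... | just e′ with e′ Fin.≟ e
    ... | yes refl = trans (choiceOf-∖ u uu) s
    ... | no e′≢e with ∧-true⁻ (search-just (linksToRoot u) s)
    ... | se′ , jt′ with joinsTo-sound {R} {u} {e} jt | joinsTo-sound {R} {u} {e′} jt′
    ... | ρ , rρ , J | ρ′ , rρ′ , J′ with ρ Fin.≟ ρ′
    ... | yes refl = ⊥-elim (IsForest.acyclic F (u , e , e′ ∷ [] ,
                       step e (lookup⇒∈ se) J (step e′ (lookup⇒∈ se′) (joins-sym J′) stop) ,
                       ((λ eq → e′≢e (sym eq)) ∷ []) ∷ [] ∷ []))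
    ... | no ρ≢ρ′ = ⊥-elim (ρ≢ρ′ (IsForest.roots-apart F ρ ρ′ rρ rρ′ (e ∷ e′ ∷ [] ,
                       step e (lookup⇒∈ se) (joins-sym J) (step e′ (lookup⇒∈ se′) J′ stop))))

    other-end-not-root : ∀ {e x y} → lookup S e ≡ true → Joins G e x y → R x ≡ true → R y ≡ false
    other-end-not-root {e} {x} {y} se j rx with bool-cases (R y)
    ... | inj₂ p  = p
    ... | inj₁ ry = ⊥-elim (joins-distinct j (IsForest.roots-apart F x y rx ry (e ∷ [] , step e (lookup⇒∈ se) j stop)))

    S′ : EdgeSet
    S′ = tabulate (λ e → lookup S e ∧ not (R (src e) ∨ R (tgt e)))

    S′-lookup : ∀ e → lookup S′ e ≡ (lookup S e ∧ not (R (src e) ∨ R (tgt e)))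
    S′-lookup e = lookup∘tabulate (λ e → lookup S e ∧ not (R (src e) ∨ R (tgt e))) e

    S′⊆S : ∀ e → lookup S′ e ≡ true → lookup S e ≡ true
    S′⊆S e h = proj₁ (∧-true⁻ (trans (sym (S′-lookup e)) h))

    S′-intro : ∀ {e} → lookup S e ≡ true → R (src e) ≡ false → R (tgt e) ≡ false → lookup S′ e ≡ true
    S′-intro {e} se rs rt rewrite S′-lookup e | se | rs | rt = refl

    root-edge-∉S′ : ∀ {e c ρ} → Joins G e c ρ → R ρ ≡ true → lookup S′ e ≡ false
    root-edge-∉S′ {e} j rρ with joins-ends j
    ... | inj₁ (_ , refl) rewrite S′-lookup e | rρ | ∨-zeroʳ (R (src e)) | ∧-zeroʳ (lookup S e) = refl
    ... | inj₂ (refl , _) rewrite S′-lookup e | rρ | ∧-zeroʳ (lookup S e) = refl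

    picks-root-edge : ∀ {e x y} → lookup S e ≡ true → Joins G e x y → R x ≡ true → picks choiceOf e ≡ true
    picks-root-edge {e} {x} {y} se j rx =
      picks-intro {choiceOf} (choiceOf-forced se (joinsTo-complete {R} (joins-sym j) rx) (∖-intro {W} {R} wy ry))
                  (joins-endpoint (joins-sym j))
      where
      wy : W y ≡ true
      wy = let ws , wt = IsForest.edges-inside F e se in proj₂ (joins-both (λ z → W z ≡ true) ws wt j)
      ry : R y ≡ false
      ry = other-end-not-root se j rx

    S-lookup : ∀ e → lookup S e ≡ (lookup S′ e ∨ picks choiceOf e)
    S-lookup e rewrite S′-lookup e with bool-cases (lookup S e)
    ... | inj₂ ¬se rewrite ¬se = not-picked
      where
      not-picked : false ≡ picks choiceOf e
      not-picked with bool-cases (picks choiceOf e)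
      ... | inj₂ p = sym p
      ... | inj₁ p with picks-sound {choiceOf} p
      ... | w , eqw , _ = ⊥-elim (false≢true (trans (sym ¬se) (choiceOf-just eqw)))
    ... | inj₁ se with bool-cases (R (src e)) | bool-cases (R (tgt e))
    ... | inj₁ rs | _ rewrite se | rs = sym (picks-root-edge se (joins-src-tgt e) rs)
    ... | inj₂ rs | inj₁ rt rewrite se | rs | rt = sym (picks-root-edge se (joins-sym (joins-src-tgt e)) rt)
    ... | inj₂ rs | inj₂ rt rewrite se | rs | rt = refl

    S≡addPicked : S ≡ addPicked choiceOf S′
    S≡addPicked = vec-ext S (addPicked choiceOf S′) (λ e → trans (S-lookup e) (sym (addPicked-lookup choiceOf S′ e)))

    reaches-nextRoot : ∀ {v ρ es} → (W ∖ R) v ≡ true → Walk G S v ρ es → R ρ ≡ true →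
                       ∃ λ c → nextRoots W R choiceOf c ≡ true × ∃ λ es′ → Walk G S′ v c es′
    reaches-nextRoot {v} uv stop rρ = ⊥-elim (∖-disjoint {W} {R} {v} uv rρ)
    reaches-nextRoot {v} uv (step {w = x} e m j w) rρ with bool-cases (R x)
    ... | inj₁ rx = v , nextRoots-intro {W} {R} {choiceOf} choiceOf-valid (choiceOf-forced (∈⇒lookup m) (joinsTo-complete {R} j rx) uv) ,
                    [] , stop
    ... | inj₂ rx with reaches-nextRoot (∖-intro {W} {R} wx rx) w rρ
      where
      wx : W x ≡ true
      wx = let ws , wt = IsForest.edges-inside F e (∈⇒lookup m) in proj₂ (joins-both (λ z → W z ≡ true) ws wt j)
    ... | c , cc , es′ , wk′ =
      let rs , rt = joins-ends-both (λ z → R z ≡ false) j (proj₂ (∖-elim {W} {R} uv)) rx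
      in c , cc , e ∷ es′ , step e (lookup⇒∈ (S′-intro (∈⇒lookup m) rs rt)) j wk′

    -- Two next roots joined inside S′ are joined through their picked edges: to distinct roots of R,
    -- or to the same root, closing a cycle.
    nextRoots-apart : ∀ c₁ c₂ → nextRoots W R choiceOf c₁ ≡ true → nextRoots W R choiceOf c₂ ≡ true →
                      (∃ λ es → Walk G S′ c₁ c₂ es) → c₁ ≡ c₂
    nextRoots-apart c₁ c₂ n₁ n₂ (es , wk) with c₁ Fin.≟ c₂
    ... | yes c₁≡c₂ = c₁≡c₂
    ... | no c₁≢c₂ with nextRoots-just {W} {R} {choiceOf} n₁ | nextRoots-just {W} {R} {choiceOf} n₂
    ... | e₁ , eq₁ | e₂ , eq₂ with picked-edge {W} {R} {choiceOf} choiceOf-valid eq₁ | picked-edge {W} {R} {choiceOf} choiceOf-valid eq₂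
    ... | u₁ , ρ₁ , r₁ , J₁ | _ , ρ₂ , r₂ , J₂ with ρ₁ Fin.≟ ρ₂
    ... | no ρ₁≢ρ₂ = ⊥-elim (ρ₁≢ρ₂ (IsForest.roots-apart F ρ₁ ρ₂ r₁ r₂ (e₁ ∷ es ++ e₂ ∷ [] ,
                       step e₁ (lookup⇒∈ (choiceOf-just eq₁)) (joins-sym J₁)
                         (walk-mono S′⊆S wk ++ʷ step e₂ (lookup⇒∈ (choiceOf-just eq₂)) J₂ stop))))
    ... | yes refl with walk⇒trail wk
    ... | ts , tw , t! = ⊥-elim (IsForest.acyclic F (ρ₁ , e₁ , ts ++ e₂ ∷ [] ,
                       step e₁ (lookup⇒∈ (choiceOf-just eq₁)) (joins-sym J₁)
                         (walk-mono S′⊆S tw ++ʷ step e₂ (lookup⇒∈ (choiceOf-just eq₂)) J₂ stop) ,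
                       All.tabulate e₁∉ ∷ ++⁺ t! ([] ∷ []) (λ { (z∈ , here refl) → e₂∉ z∈ })))
      where
      ts⊆S′ : All (λ f → lookup S′ f ≡ true) ts
      ts⊆S′ = walk-edges tw
      e₂∉ : e₂ ∈ ts → ⊥
      e₂∉ z∈ = false≢true (trans (sym (root-edge-∉S′ J₂ r₂)) (All.lookup ts⊆S′ z∈))
      e₁∉ : ∀ {z} → z ∈ ts ++ e₂ ∷ [] → e₁ ≢ z
      e₁∉ z∈ refl with ∈-++⁻ ts z∈
      ... | inj₁ a = false≢true (trans (sym (root-edge-∉S′ J₁ r₁)) (All.lookup ts⊆S′ a))
      ... | inj₂ (here refl) with joins-same J₁ J₂
      ... | inj₁ (c₁≡c₂ , _) = c₁≢c₂ c₁≡c₂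
      ... | inj₂ (c₁≡ρ , _) = ∖-disjoint {W} {R} {c₁} u₁ (subst (λ z → R z ≡ true) (sym c₁≡ρ) r₁)

    innerForest : IsForest (W ∖ R) (nextRoots W R choiceOf) S′
    innerForest = record
      { edges-inside = inside
      ; acyclic      = λ (u , e₀ , es , wk , u!) → IsForest.acyclic F (u , e₀ , es , walk-mono S′⊆S wk , u!)
      ; reaches-root = λ v uv → let ρ , rρ , es , wk = IsForest.reaches-root F v (proj₁ (∖-elim {W} {R} uv))
                                in reaches-nextRoot uv wk rρ
      ; roots-apart  = nextRoots-apart
      }
      where
      inside : ∀ e → lookup S′ e ≡ true → (W ∖ R) (src e) ≡ true × (W ∖ R) (tgt e) ≡ true
      inside e h with ∧-true⁻ (trans (sym (S′-lookup e)) h)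
      ... | se , ¬r with not-∨-true⁻ {R (src e)} ¬r | IsForest.edges-inside F e se
      ... | rs , rt | ws , wt = ∖-intro {W} {R} ws rs , ∖-intro {W} {R} wt rt

  inner-unpicked : ∀ {W R C ch S′} → ValidChoice W R ch → IsForest (W ∖ R) C S′ →
                   ∀ {e} → lookup S′ e ≡ true → picks ch e ≡ false
  inner-unpicked {W} {R} {C} {ch} valid F′ {e} s′e with bool-cases (picks ch e)
  ... | inj₂ p = p
  ... | inj₁ p with picks-sound {ch} p
  ... | w , eqw , _ with picked-edge {W} {R} {ch} valid eqw
  ... | _ , ρ , rρ , J =
    let us , ut = IsForest.edges-inside F′ e s′e
    in ⊥-elim (∖-disjoint {W} {R} {ρ} (proj₂ (joins-both (λ z → (W ∖ R) z ≡ true) us ut J)) rρ)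

  addPicked-injective : ∀ {W R C₁ C₂ ch S₁ S₂} → ValidChoice W R ch → IsForest (W ∖ R) C₁ S₁ → IsForest (W ∖ R) C₂ S₂ →
                        addPicked ch S₁ ≡ addPicked ch S₂ → S₁ ≡ S₂
  addPicked-injective {W} {R} {C₁} {C₂} {ch} {S₁} {S₂} valid F₁ F₂ eq = vec-ext S₁ S₂ λ e →
    ∨-cancelʳ-disjoint (lookup S₁ e) (lookup S₂ e) (picks ch e)
      (trans (sym (addPicked-lookup ch S₁ e)) (trans (cong (λ S → lookup S e) eq) (addPicked-lookup ch S₂ e)))
      (inner-unpicked {W} {R} {C₁} {ch} valid F₁) (inner-unpicked {W} {R} {C₂} {ch} valid F₂)

  addPicked-determines-choice : ∀ {W R C₁ C₂ ch₁ ch₂ S₁ S₂} → ValidChoice W R ch₁ → ValidChoice W R ch₂ →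
    IsForest (W ∖ R) C₁ S₁ → IsForest (W ∖ R) C₂ S₂ → addPicked ch₁ S₁ ≡ addPicked ch₂ S₂ →
    ∀ v e → lookup ch₁ v ≡ just e → lookup ch₂ v ≡ just e
  addPicked-determines-choice {W} {R} {C₁} {C₂} {ch₁} {ch₂} {S₁} {S₂} valid₁ valid₂ F₁ F₂ eq v e eqv
    with picked-edge {W} {R} {ch₁} valid₁ eqv
  ... | uv , ρ , rρ , J with ∨-true⁻ {lookup S₂ e} e∈addPicked₂
    where
    picked₁ : picks ch₁ e ≡ true
    picked₁ = picks-intro {ch₁} eqv (joins-endpoint J)
    e∈addPicked₂ : lookup S₂ e ∨ picks ch₂ e ≡ true
    e∈addPicked₂ = trans (sym (addPicked-lookup ch₂ S₂ e))
                     (trans (cong (λ S → lookup S e) (sym eq)) (trans (addPicked-lookup ch₁ S₁ e) (∨-true⁺ʳ (lookup S₁ e) picked₁)))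
  ... | inj₁ s₂e = ⊥-elim (false≢true (trans (sym (inner-unpicked {W} {R} {C₂} {ch₁} valid₁ F₂ s₂e))
                                              (picks-intro {ch₁} eqv (joins-endpoint J))))
  ... | inj₂ p₂ with picks-sound {ch₂} p₂
  ... | w , eqw , _ with picked-edge {W} {R} {ch₂} valid₂ eqw
  ... | _ , ρ′ , rρ′ , J′ with joins-same J J′
  ... | inj₁ (refl , _) = eqw
  ... | inj₂ (v≡ρ′ , _) = ⊥-elim (∖-disjoint {W} {R} {v} uv (subst (λ z → R z ≡ true) (sym v≡ρ′) rρ′))

  module Layer (W R : VertexSet) (R⊆W : ∀ v → R v ≡ true → W v ≡ true)
               (inner : (C : VertexSet) → (∀ v → C v ≡ true → (W ∖ R) v ≡ true) → Enumeration (W ∖ R) C) where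

    innerEnumeration : (ch : Choice) → Enumeration (W ∖ R) (nextRoots W R ch)
    innerEnumeration ch = inner (nextRoots W R ch) (nextRoots⊆∖ W R ch)

    extend : Choice → List EdgeSet
    extend ch = map (addPicked ch) (Enumeration.forests (innerEnumeration ch))

    forests : List EdgeSet
    forests = concatMap extend (allVecs (options W R))

    inner-sound : ∀ ch {S′} → S′ ∈ Enumeration.forests (innerEnumeration ch) → IsForest (W ∖ R) (nextRoots W R ch) S′
    inner-sound ch {S′} = Enumeration.sound (innerEnumeration ch) S′

    extend-injective : ∀ {ch} → ch ∈ allVecs (options W R) → Unique (extend ch)
    extend-injective {ch} ch∈ =
      unique-map⁺ (addPicked ch) (Enumeration.unique (innerEnumeration ch)) λ S₁∈ S₂∈ →
        addPicked-injective {W} {R} {nextRoots W R ch} {nextRoots W R ch} {ch} (∈-allVecs⇒valid W R ch∈)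
          (inner-sound ch S₁∈) (inner-sound ch S₂∈)

    extend-disjoint : ∀ {ch₁ ch₂ S} → ch₁ ∈ allVecs (options W R) → ch₂ ∈ allVecs (options W R) → ch₁ ≢ ch₂ →
                      S ∈ extend ch₁ → S ∈ extend ch₂ → ⊥
    extend-disjoint {ch₁} {ch₂} ch₁∈ ch₂∈ ch₁≢ch₂ S∈₁ S∈₂ with ∈-map⁻ (addPicked ch₁) S∈₁ | ∈-map⁻ (addPicked ch₂) S∈₂
    ... | S₁ , S₁∈ , refl | S₂ , S₂∈ , eq =
      ch₁≢ch₂ (vec-ext ch₁ ch₂ (λ v → ≡-by-just (determines v) (determines⁻ v)))
      where
      valid₁ = ∈-allVecs⇒valid W R ch₁∈
      valid₂ = ∈-allVecs⇒valid W R ch₂∈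
      determines : ∀ v e → lookup ch₁ v ≡ just e → lookup ch₂ v ≡ just e
      determines = addPicked-determines-choice {W} {R} {nextRoots W R ch₁} {nextRoots W R ch₂} {ch₁} {ch₂}
                     valid₁ valid₂ (inner-sound ch₁ S₁∈) (inner-sound ch₂ S₂∈) eq
      determines⁻ : ∀ v e → lookup ch₂ v ≡ just e → lookup ch₁ v ≡ just e
      determines⁻ = addPicked-determines-choice {W} {R} {nextRoots W R ch₂} {nextRoots W R ch₁} {ch₂} {ch₁}
                      valid₂ valid₁ (inner-sound ch₂ S₂∈) (inner-sound ch₁ S₁∈) (sym eq)

    sound : ∀ S → S ∈ forests → IsForest W R S
    sound S S∈ with ∈-concatMap⁻′ extend (allVecs (options W R)) S∈
    ... | ch , ch∈ , S∈′ with ∈-map⁻ (addPicked ch) S∈′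
    ... | S′ , S′∈ , refl = Assemble.forest W R R⊆W ch (∈-allVecs⇒valid W R ch∈) S′ (inner-sound ch S′∈)

    complete : ∀ S → IsForest W R S → S ∈ forests
    complete S F = subst (_∈ forests) (sym S≡addPicked)
      (∈-concatMap⁺′ {f = extend} ch∈ (∈-map⁺ (addPicked ch) (Enumeration.complete (innerEnumeration ch) S′ innerForest)))
      where
      open Decompose W R S F
      ch = choiceOf
      ch∈ : ch ∈ allVecs (options W R)
      ch∈ = ∈-allVecs⁺ (options W R) ch (λ v → ∈-options⁺ W R v _ (choiceOf-valid v))

    enumeration : Enumeration W R
    enumeration = record
      { forests  = forests
      ; unique   = unique-concatMap⁺ extend (allVecs-unique (options W R) (options-unique W R)) extend-injective extend-disjoint
      ; sound    = sound
      ; complete = complete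
      }

    length-enumeration : length forests ≡ sumL (allVecs (options W R)) (λ ch → length (Enumeration.forests (innerEnumeration ch)))
    length-enumeration =
      trans (length-concatMap extend (allVecs (options W R)))
            (sumL-cong (allVecs (options W R)) (λ ch _ → length-map (addPicked ch) (Enumeration.forests (innerEnumeration ch))))

  ∅ : EdgeSet
  ∅ = Sub.⊥

  ∅-lookup : ∀ e → lookup ∅ e ≡ false
  ∅-lookup e = lookup-replicate e false

  module NoRoots (W R : VertexSet) (no-root : ∀ v → R v ≡ false) where

    empty-enumeration : (∀ v → W v ≡ false) → Enumeration W R
    empty-enumeration W≡∅ = record
      { forests  = ∅ ∷ []
      ; unique   = [] ∷ []
      ; sound    = λ { S (here refl) → ∅-forest }
      ; complete = λ S F → here (vec-ext S ∅ (λ e → S≡∅ S F e))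
      }
      where
      ∅-forest : IsForest W R ∅
      ∅-forest = record
        { edges-inside = λ e h → ⊥-elim (false≢true (trans (sym (∅-lookup e)) h))
        ; acyclic      = λ { (_ , e₀ , _ , step .e₀ m _ _ , _) → false≢true (trans (sym (∅-lookup e₀)) (∈⇒lookup m)) }
        ; reaches-root = λ v h → ⊥-elim (false≢true (trans (sym (W≡∅ v)) h))
        ; roots-apart  = λ ρ₁ _ r → ⊥-elim (false≢true (trans (sym (no-root ρ₁)) r))
        }
      S≡∅ : ∀ S → IsForest W R S → ∀ e → lookup S e ≡ lookup ∅ e
      S≡∅ S F e with bool-cases (lookup S e)
      ... | inj₂ p = trans p (sym (∅-lookup e))
      ... | inj₁ p = ⊥-elim (false≢true (trans (sym (W≡∅ (src e))) (proj₁ (IsForest.edges-inside F e p))))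

    unrooted-enumeration : ∀ v → W v ≡ true → Enumeration W R
    unrooted-enumeration v wv = record
      { forests  = []
      ; unique   = []
      ; sound    = λ S ()
      ; complete = λ S F → let ρ , r , _ = IsForest.reaches-root F v wv in ⊥-elim (false≢true (trans (sym (no-root ρ)) r))
      }

  allVertices : VertexSet
  allVertices _ = true

  singleton : Vertex → VertexSet
  singleton r v = v ≡ᵇ r

  spanningTree⇒forest : ∀ r S → IsSpanningTree G S → IsForest allVertices (singleton r) S
  spanningTree⇒forest r S (connected , acyclic) = record
    { edges-inside = λ e _ → refl , refl
    ; acyclic      = acyclic
    ; reaches-root = λ v _ → r , ≡ᵇ-refl r , connected v r
    ; roots-apart  = λ ρ₁ ρ₂ r₁ r₂ _ → trans (≡ᵇ⇒≡ r₁) (sym (≡ᵇ⇒≡ r₂))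
    }

  forest⇒spanningTree : ∀ r S → IsForest allVertices (singleton r) S → IsSpanningTree G S
  forest⇒spanningTree r S F = connected , IsForest.acyclic F
    where
    connected : Connected G S
    connected u v with IsForest.reaches-root F u refl | IsForest.reaches-root F v refl
    ... | ρ , rρ , es , wk | ρ′ , rρ′ , _ , wk′ with ≡ᵇ⇒≡ {i = ρ} rρ | ≡ᵇ⇒≡ {i = ρ′} rρ′
    ... | refl | refl = let fs , wk⁻ = reverseWalk wk′ in es ++ fs , wk ++ʷ wk⁻

module CompleteBipartite (m n : ℕ) (k : Fin m → ℕ) where

  G : Multigraph
  G = genCompleteBipartite m n k

  qv : Fin m → Fin (n + m)
  qv i = n ↑ʳ i

  pv : Fin n → Fin (n + m)
  pv j = j ↑ˡ m

  row : Fin m → List (Fin (n + m) × Fin (n + m))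
  row i = concatMap (λ j → replicate (k i) (qv i , pv j)) (allFin n)

  isQ isP : Fin (n + m) → Bool
  isQ v = [ (λ _ → false) , (λ _ → true) ]′ (splitAt n v)
  isP v = not (isQ v)

  weight : Fin (n + m) → ℕ
  weight v = [ (λ _ → 0) , k ]′ (splitAt n v)

  isQ-qv : ∀ i → isQ (qv i) ≡ true
  isQ-qv i rewrite splitAt-↑ʳ n m i = refl

  isQ-pv : ∀ j → isQ (pv j) ≡ false
  isQ-pv j rewrite splitAt-↑ˡ n j m = refl

  weight-qv : ∀ i → weight (qv i) ≡ k i
  weight-qv i rewrite splitAt-↑ʳ n m i = refl

  vertex-cases : ∀ v → (∃ λ j → v ≡ pv j) ⊎ (∃ λ i → v ≡ qv i)
  vertex-cases v with splitAt n v in eq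
  ... | inj₁ j = inj₁ (j , sym (splitAt⁻¹-↑ˡ eq))
  ... | inj₂ i = inj₂ (i , sym (splitAt⁻¹-↑ʳ eq))

  qv≢pv : ∀ i j → qv i ≢ pv j
  qv≢pv i j eq = false≢true (trans (sym (isQ-pv j)) (trans (cong isQ (sym eq)) (isQ-qv i)))

  qv-≡ᵇ : ∀ i i₀ → qv i ≡ᵇ qv i₀ ≡ i ≡ᵇ i₀
  qv-≡ᵇ i i₀ with i Fin.≟ i₀
  ... | yes refl = ≡ᵇ-refl (qv i)
  ... | no i≢i₀  = ≢⇒≡ᵇ-false (i≢i₀ ∘ ↑ʳ-injective n i i₀)

  pv-≡ᵇ : ∀ j j₀ → pv j ≡ᵇ pv j₀ ≡ j ≡ᵇ j₀
  pv-≡ᵇ j j₀ with j Fin.≟ j₀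
  ... | yes refl = ≡ᵇ-refl (pv j)
  ... | no j≢j₀  = ≢⇒≡ᵇ-false (j≢j₀ ∘ ↑ˡ-injective m j j₀)

  ∈-edges⁻ : ∀ {x} → x ∈ concatMap row (allFin m) → ∃₂ λ i j → x ≡ (qv i , pv j)
  ∈-edges⁻ x∈ with ∈-concatMap⁻′ row (allFin m) x∈
  ... | i , _ , x∈row with ∈-concatMap⁻′ (λ j → replicate (k i) (qv i , pv j)) (allFin n) x∈row
  ... | j , _ , x∈rep = i , j , ∈-replicate⁻ x∈rep

  edge-shape : ∀ e → ∃₂ λ i j → ends G e ≡ (qv i , pv j)
  edge-shape e = ∈-edges⁻ (∈-lookup {xs = edges G} e)

  loopless : ∀ e → proj₁ (ends G e) ≢ proj₂ (ends G e)
  loopless e eq =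
    let i , j , shape = edge-shape e in qv≢pv i j (trans (sym (cong proj₁ shape)) (trans eq (cong proj₂ shape)))

  open RootedForests G loopless

  joins-opposite-sides : ∀ {e x y} → Joins G e x y → isQ x ≡ not (isQ y)
  joins-opposite-sides {e} = let i , j , shape = edge-shape e in opposite i j shape
    where
    opposite : ∀ {xy : Fin (n + m) × Fin (n + m)} {x y} i j → xy ≡ (qv i , pv j) → xy ≡ (x , y) ⊎ xy ≡ (y , x) →
               isQ x ≡ not (isQ y)
    opposite i j refl (inj₁ refl) rewrite isQ-qv i | isQ-pv j = refl
    opposite i j refl (inj₂ refl) rewrite isQ-qv i | isQ-pv j = refl

  OnP OnQ : VertexSet → Set
  OnP R = ∀ v → R v ≡ true → isQ v ≡ false
  OnQ R = ∀ v → R v ≡ true → isQ v ≡ true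

  countP countQ : VertexSet → ℕ
  countP S = count (λ v → isP v ∧ S v)
  countQ S = count (λ v → isQ v ∧ S v)

  weightQ weightProdQ : VertexSet → ℕ
  weightQ S     = sumF (λ v → if isQ v ∧ S v then weight v else 0)
  weightProdQ S = prodF (λ v → if isQ v ∧ S v then weight v else 1)

  weightQ-∖ : ∀ W R → (∀ v → R v ≡ true → W v ≡ true) → weightQ W ≡ weightQ R + weightQ (W ∖ R)
  weightQ-∖ W R R⊆W =
    trans (sumF-cong split) (sumF-+ (λ v → if isQ v ∧ R v then weight v else 0) (λ v → if isQ v ∧ (W ∖ R) v then weight v else 0))
    where
    split : ∀ v → (if isQ v ∧ W v then weight v else 0)
                  ≡ (if isQ v ∧ R v then weight v else 0) + (if isQ v ∧ (W ∖ R) v then weight v else 0)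
    split v with isQ v | bool-cases (R v)
    ... | false | _ = refl
    ... | true | inj₁ r rewrite r | R⊆W v r = sym (+-identityʳ _)
    ... | true | inj₂ r rewrite r with W v
    ... | true  = refl
    ... | false = refl

  degreeInto : VertexSet → Fin (n + m) → ℕ
  degreeInto R v = if isQ v then weight v * countP R else weightQ R

  pairJoinsTo : VertexSet → Fin (n + m) → Fin (n + m) × Fin (n + m) → Bool
  pairJoinsTo R v xy = (proj₁ xy ≡ᵇ v ∧ R (proj₂ xy)) ∨ (proj₂ xy ≡ᵇ v ∧ R (proj₁ xy))

  degree-sum : ∀ R v → length (filterᵇ (joinsTo R v) (allFin (E G)))
                       ≡ sumF (λ i → sumF (λ j → k i * 𝟙 (pairJoinsTo R v (qv i , pv j))))
  degree-sum R v =
    trans (length-filterᵇ-tabulate (joinsTo R v) (λ e → e))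
    (trans (sumF-lookup (edges G) (𝟙 ∘ pairJoinsTo R v))
    (trans (sumL-concatMap row (allFin m) (𝟙 ∘ pairJoinsTo R v))
    (trans (sumL-cong (allFin m) (λ i _ → row-sum i))
           (sumL-tabulate (λ i → i) (λ i → sumF (λ j → k i * 𝟙 (pairJoinsTo R v (qv i , pv j))))))))
    where
    row-sum : ∀ i → sumL (row i) (𝟙 ∘ pairJoinsTo R v) ≡ sumF (λ j → k i * 𝟙 (pairJoinsTo R v (qv i , pv j)))
    row-sum i =
      trans (sumL-concatMap (λ j → replicate (k i) (qv i , pv j)) (allFin n) (𝟙 ∘ pairJoinsTo R v))
        (trans (sumL-cong (allFin n) (λ j _ → sumL-replicate (k i) (qv i , pv j) (𝟙 ∘ pairJoinsTo R v)))
               (sumL-tabulate (λ j → j) (λ j → k i * 𝟙 (pairJoinsTo R v (qv i , pv j)))))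

  *-𝟙 : ∀ c b → c * 𝟙 b ≡ (if b then c else 0)
  *-𝟙 c true  = *-identityʳ c
  *-𝟙 c false = *-zeroʳ c

  *-𝟙-∧ : ∀ c d r → c * 𝟙 (d ∧ r) ≡ (if d then c * 𝟙 r else 0)
  *-𝟙-∧ c true  r = refl
  *-𝟙-∧ c false r = *-zeroʳ c

  sumF-if : ∀ {N} d c (f : Fin N → ℕ) → sumF (λ j → if d then c * f j else 0) ≡ (if d then c * sumF f else 0)
  sumF-if     true  c f = sumF-*ˡ c f
  sumF-if {N} false c f = sumF-zero {N} (λ _ → 0) (λ _ → refl)

  degree-qv : ∀ R i₀ → length (filterᵇ (joinsTo R (qv i₀)) (allFin (E G))) ≡ degreeInto R (qv i₀)
  degree-qv R i₀ = begin
    length (filterᵇ (joinsTo R (qv i₀)) (allFin (E G)))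
      ≡⟨ degree-sum R (qv i₀) ⟩
    sumF (λ i → sumF (λ j → k i * 𝟙 (pairJoinsTo R (qv i₀) (qv i , pv j))))
      ≡⟨ sumF-cong (λ i → sumF-cong (λ j → trans (cong (λ b → k i * 𝟙 b) (joins i j)) (*-𝟙-∧ (k i) (i ≡ᵇ i₀) (R (pv j))))) ⟩
    sumF (λ i → sumF (λ j → if i ≡ᵇ i₀ then k i * 𝟙 (R (pv j)) else 0))
      ≡⟨ sumF-cong (λ i → sumF-if (i ≡ᵇ i₀) (k i) (λ j → 𝟙 (R (pv j)))) ⟩
    sumF (λ i → if i ≡ᵇ i₀ then k i * sumF (λ j → 𝟙 (R (pv j))) else 0)
      ≡⟨ sumF-δ i₀ (λ i → k i * sumF (λ j → 𝟙 (R (pv j)))) ⟩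
    k i₀ * sumF (λ j → 𝟙 (R (pv j)))
      ≡⟨ sym degree ⟩
    degreeInto R (qv i₀) ∎
    where
    open ≡-Reasoning
    joins : ∀ i j → pairJoinsTo R (qv i₀) (qv i , pv j) ≡ (i ≡ᵇ i₀ ∧ R (pv j))
    joins i j = trans (cong₂ (λ a b → (a ∧ R (pv j)) ∨ (b ∧ R (qv i))) (qv-≡ᵇ i i₀) (≢⇒≡ᵇ-false (qv≢pv i₀ j ∘ sym)))
                      (∨-identityʳ (i ≡ᵇ i₀ ∧ R (pv j)))
    degree : degreeInto R (qv i₀) ≡ k i₀ * sumF (λ j → 𝟙 (R (pv j)))
    degree = trans (cong (λ b → if b then weight (qv i₀) * countP R else weightQ R) (isQ-qv i₀))
      (cong₂ _*_ (weight-qv i₀)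
        (trans (sumF-↑ n (λ u → 𝟙 (isP u ∧ R u)))
          (trans (cong₂ _+_ (sumF-cong (λ j → cong (λ b → 𝟙 (not b ∧ R (pv j))) (isQ-pv j)))
                            (sumF-zero _ (λ i → cong (λ b → 𝟙 (not b ∧ R (qv i))) (isQ-qv i))))
                 (+-identityʳ _))))

  degree-pv : ∀ R j₀ → length (filterᵇ (joinsTo R (pv j₀)) (allFin (E G))) ≡ degreeInto R (pv j₀)
  degree-pv R j₀ = begin
    length (filterᵇ (joinsTo R (pv j₀)) (allFin (E G)))
      ≡⟨ degree-sum R (pv j₀) ⟩
    sumF (λ i → sumF (λ j → k i * 𝟙 (pairJoinsTo R (pv j₀) (qv i , pv j))))
      ≡⟨ sumF-cong (λ i → sumF-cong (λ j → trans (cong (λ b → k i * 𝟙 b) (joins i j)) (*-𝟙-∧ (k i) (j ≡ᵇ j₀) (R (qv i))))) ⟩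
    sumF (λ i → sumF (λ j → if j ≡ᵇ j₀ then k i * 𝟙 (R (qv i)) else 0))
      ≡⟨ sumF-cong (λ i → sumF-δ j₀ (λ j → k i * 𝟙 (R (qv i)))) ⟩
    sumF (λ i → k i * 𝟙 (R (qv i)))
      ≡⟨ sumF-cong (λ i → *-𝟙 (k i) (R (qv i))) ⟩
    sumF (λ i → if R (qv i) then k i else 0)
      ≡⟨ sym degree ⟩
    degreeInto R (pv j₀) ∎
    where
    open ≡-Reasoning
    joins : ∀ i j → pairJoinsTo R (pv j₀) (qv i , pv j) ≡ (j ≡ᵇ j₀ ∧ R (qv i))
    joins i j = cong₂ (λ a b → (a ∧ R (pv j)) ∨ (b ∧ R (qv i))) (≢⇒≡ᵇ-false (qv≢pv i j₀)) (pv-≡ᵇ j j₀)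
    degree : degreeInto R (pv j₀) ≡ sumF (λ i → if R (qv i) then k i else 0)
    degree = trans (cong (λ b → if b then weight (pv j₀) * countP R else weightQ R) (isQ-pv j₀))
      (trans (sumF-↑ n (λ v → if isQ v ∧ R v then weight v else 0))
        (cong₂ _+_ (sumF-zero _ (λ j → cong (λ b → if b ∧ R (pv j) then weight (pv j) else 0) (isQ-pv j)))
                   (sumF-cong (λ i → trans (cong (λ b → if b ∧ R (qv i) then weight (qv i) else 0) (isQ-qv i))
                                           (cong (λ w → if R (qv i) then w else 0) (weight-qv i))))))

  degree : ∀ R v → length (filterᵇ (joinsTo R v) (allFin (E G))) ≡ degreeInto R v
  degree R v with vertex-cases v
  ... | inj₁ (j₀ , refl) = degree-pv R j₀
  ... | inj₂ (i₀ , refl) = degree-qv R i₀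

  sumL-options : ∀ W R v (γ : Maybe Edge → ℕ) c → (∀ e → γ (just e) ≡ c) →
                 sumL (options W R v) γ ≡ γ nothing + (if (W ∖ R) v then degreeInto R v * c else 0)
  sumL-options W R v γ c γ≡c with (W ∖ R) v
  ... | true  = cong (γ nothing +_) (trans (sumL-map just L γ) (trans (sumL-cong L (λ e _ → γ≡c e))
                                            (trans (sumL-const L c) (cong (_* c) (degree R v)))))
    where L = filterᵇ (joinsTo R v) (allFin (E G))
  ... | false = refl

  -- a is the number of vertices of W on the side opposite to R, b the number of non-roots of W on R's side.
  forestsP-formula : VertexSet → VertexSet → ℕ → ℕ → ℕ
  forestsP-formula W R zero    b = isZero b
  forestsP-formula W R (suc a) b = count R * weightProdQ W * weightQ W ^ b * (count R + b) ^ a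

  #forestsP : VertexSet → VertexSet → ℕ
  #forestsP W R = forestsP-formula W R (countQ W) (countP (W ∖ R))

  forestsQ-formula : VertexSet → VertexSet → ℕ → ℕ → ℕ
  forestsQ-formula W R zero    b = isZero b
  forestsQ-formula W R (suc a) b = weightQ R * weightProdQ (W ∖ R) * weightQ W ^ a * suc a ^ b

  #forestsQ : VertexSet → VertexSet → ℕ
  #forestsQ W R = forestsQ-formula W R (countP W) (countQ (W ∖ R))

  nextRoots-onQ : ∀ W R ch → ValidChoice W R ch → OnP R → OnQ (nextRoots W R ch)
  nextRoots-onQ W R ch valid onP v h =
    let _ , ρ , rρ , J = picked-edge {W} {R} {ch} valid (proj₂ (nextRoots-just {W} {R} {ch} h))
    in trans (joins-opposite-sides J) (cong not (onP ρ rρ))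

  nextRoots-onP : ∀ W R ch → ValidChoice W R ch → OnQ R → OnP (nextRoots W R ch)
  nextRoots-onP W R ch valid onQ v h =
    let _ , ρ , rρ , J = picked-edge {W} {R} {ch} valid (proj₂ (nextRoots-just {W} {R} {ch} h))
    in trans (joins-opposite-sides J) (cong not (onQ ρ rρ))

  module LayerSumFromP (W R : VertexSet) (onP : OnP R) where

    countP-R : countP R ≡ count R
    countP-R = sumF-cong (λ u → table (isQ u) (R u) (onP u))
      where
      table : ∀ q r → (r ≡ true → q ≡ false) → 𝟙 (not q ∧ r) ≡ 𝟙 r
      table q     true  h rewrite h refl = refl
      table true  false h = refl
      table false false h = refl

    weightQ-R : weightQ R ≡ 0
    weightQ-R = sumF-zero _ (λ v → table (isQ v) (R v) (weight v) (onP v))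
      where
      table : ∀ q r x → (r ≡ true → q ≡ false) → (if q ∧ r then x else 0) ≡ 0
      table q     true  x h rewrite h refl = refl
      table true  false x h = refl
      table false false x h = refl

    weightQ-∖R : weightQ (W ∖ R) ≡ weightQ W
    weightQ-∖R = sumF-cong (λ v → table (isQ v) (W v) (R v) (weight v) (onP v))
      where
      table : ∀ q w r x → (r ≡ true → q ≡ false) → (if q ∧ (w ∧ not r) then x else 0) ≡ (if q ∧ w then x else 0)
      table q w     true  x h rewrite h refl = refl
      table q true  false x h = refl
      table q false false x h = refl

    layer : ℕ
    layer = sumL (allVecs (options W R)) (λ ch → #forestsQ (W ∖ R) (nextRoots W R ch))

    unpicked : Vertex → Maybe Edge → ℕ
    unpicked v o = 𝟙 (not (isQ v ∧ (W ∖ R) v ∧ not (is-just o ∧ (W ∖ R) v)))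

    options-sum-unpicked : ∀ v → sumL (options W R v) (unpicked v) ≡ (if isQ v ∧ W v then countP R * weight v else 1)
    options-sum-unpicked v = trans (sumL-options W R v (unpicked v) 1 (λ e → picked (isQ v) ((W ∖ R) v)))
                                   (table (isQ v) (W v) (R v) (weight v) (countP R) (weightQ R) (onP v) weightQ-R)
      where
      picked : ∀ q u → 𝟙 (not (q ∧ u ∧ not u)) ≡ 1
      picked true  true  = refl
      picked true  false = refl
      picked false u     = refl
      table : ∀ q w r x B A → (r ≡ true → q ≡ false) → A ≡ 0 →
              𝟙 (not (q ∧ (w ∧ not r) ∧ true)) + (if w ∧ not r then (if q then x * B else A) * 1 else 0) ≡ (if q ∧ w then B * x else 1)
      table true  true  false x B A h z = trans (*-identityʳ (x * B)) (*-comm x B)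
      table true  true  true  x B A h z = case h refl of λ ()
      table true  false r     x B A h z = refl
      table false true  false x B A h z rewrite z = refl
      table false true  true  x B A h z = refl
      table false false r     x B A h z = refl

    layer-no-p-left : countP (W ∖ R) ≡ 0 → layer ≡ #forestsP W R
    layer-no-p-left eq = begin
      layer
        ≡⟨ sumL-cong (allVecs (options W R)) (λ ch _ → as-product ch) ⟩
      sumL (allVecs (options W R)) (λ ch → prodF (λ v → unpicked v (lookup ch v)))
        ≡⟨ sumL-allVecs-prodF (options W R) unpicked ⟩
      prodF (λ v → sumL (options W R v) (unpicked v))
        ≡⟨ prodF-cong options-sum-unpicked ⟩
      prodF (λ v → if isQ v ∧ W v then countP R * weight v else 1)
        ≡⟨ prodF-scale-on (λ v → isQ v ∧ W v) weight (countP R) ⟩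
      weightProdQ W * countP R ^ countQ W
        ≡⟨ closed (countQ W) refl ⟩
      #forestsP W R ∎
      where
      open ≡-Reasoning
      as-product : ∀ ch → #forestsQ (W ∖ R) (nextRoots W R ch) ≡ prodF (λ v → unpicked v (lookup ch v))
      as-product ch = trans (cong (λ z → forestsQ-formula (W ∖ R) (nextRoots W R ch) z (countQ ((W ∖ R) ∖ nextRoots W R ch))) eq)
                            (isZero-count (λ v → isQ v ∧ (W ∖ R) v ∧ not (nextRoots W R ch v)))
      closed : ∀ a → countQ W ≡ a → weightProdQ W * countP R ^ countQ W ≡ #forestsP W R
      closed zero    eqa rewrite eqa | eq | prodF-on-empty (λ v → isQ v ∧ W v) weight eqa = refl
      closed (suc a) eqa rewrite eqa | eq | countP-R | +-identityʳ (count R) =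
        solve 3 (λ P b c → P :* (b :* c) := b :* P :* con 1 :* c) refl (weightProdQ W) (count R) (count R ^ a)

    unpickedFactor : ℕ → Vertex → Maybe Edge → ℕ
    unpickedFactor N v o = if isQ v ∧ (W ∖ R) v ∧ not (is-just o ∧ (W ∖ R) v) then N * weight v else 1

    pickedWeight : Vertex → Maybe Edge → ℕ
    pickedWeight v o = if isQ v ∧ (is-just o ∧ (W ∖ R) v) then weight v else 0

    options-sum-unpickedFactor : ∀ N v → sumL (options W R v) (unpickedFactor N v) ≡ (if isQ v ∧ W v then (N + countP R) * weight v else 1)
    options-sum-unpickedFactor N v =
      trans (sumL-options W R v (unpickedFactor N v) 1 (λ e → picked (isQ v) ((W ∖ R) v) (N * weight v)))
            (table (isQ v) (W v) (R v) (weight v) (countP R) (weightQ R) (onP v) weightQ-R)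
      where
      picked : ∀ q u a → (if q ∧ u ∧ not u then a else 1) ≡ 1
      picked true  true  a = refl
      picked true  false a = refl
      picked false u     a = refl
      table : ∀ q w r x B A → (r ≡ true → q ≡ false) → A ≡ 0 →
              (if q ∧ (w ∧ not r) ∧ true then N * x else 1) + (if w ∧ not r then (if q then x * B else A) * 1 else 0)
              ≡ (if q ∧ w then (N + B) * x else 1)
      table true  true  false x B A h z = solve 3 (λ N x B → N :* x :+ x :* B :* con 1 := (N :+ B) :* x) refl N x B
      table true  true  true  x B A h z = case h refl of λ ()
      table true  false r     x B A h z = refl
      table false true  false x B A h z rewrite z = refl
      table false true  true  x B A h z = refl
      table false false r     x B A h z = refl

    options-sum-pickedWeight : ∀ N v → sumL (options W R v) (λ o → unpickedFactor N v o * pickedWeight v o)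
                                       ≡ (if isQ v ∧ W v then countP R * weight v * weight v else 0)
    options-sum-pickedWeight N v =
      trans (sumL-options W R v (λ o → unpickedFactor N v o * pickedWeight v o) _ (λ e → refl))
            (table (isQ v) (W v) (R v) (weight v) (countP R) (weightQ R) (onP v) weightQ-R)
      where
      table : ∀ q w r x B A → (r ≡ true → q ≡ false) → A ≡ 0 →
              (if q ∧ (w ∧ not r) ∧ true then N * x else 1) * (if q ∧ false then x else 0)
              + (if w ∧ not r then (if q then x * B else A) * ((if q ∧ (w ∧ not r) ∧ not (w ∧ not r) then N * x else 1)
                                                             * (if q ∧ (w ∧ not r) then x else 0)) else 0)
              ≡ (if q ∧ w then B * x * x else 0)
      table true  true  false x B A h z = solve 3 (λ N x B → N :* x :* con 0 :+ x :* B :* (con 1 :* x) := B :* x :* x) refl N x B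
      table true  true  true  x B A h z = case h refl of λ ()
      table true  false r     x B A h z = refl
      table false true  false x B A h z rewrite z = refl
      table false true  true  x B A h z = refl
      table false false r     x B A h z = refl

    forestsQ-as-product : ∀ n₀ → countP (W ∖ R) ≡ suc n₀ → ∀ ch →
      #forestsQ (W ∖ R) (nextRoots W R ch)
      ≡ weightQ (W ∖ R) ^ n₀ * (prodF (λ v → unpickedFactor (suc n₀) v (lookup ch v)) * sumF (λ v → pickedWeight v (lookup ch v)))
    forestsQ-as-product n₀ eq ch =
      trans (cong (λ z → forestsQ-formula (W ∖ R) C z (countQ ((W ∖ R) ∖ C))) eq)
        (trans (solve 4 (λ a p x y → a :* p :* x :* y := x :* ((p :* y) :* a)) refl
                        (weightQ C) (weightProdQ ((W ∖ R) ∖ C)) (weightQ (W ∖ R) ^ n₀) (suc n₀ ^ countQ ((W ∖ R) ∖ C)))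
               (cong (λ P → weightQ (W ∖ R) ^ n₀ * (P * weightQ C))
                     (sym (prodF-scale-on (λ v → isQ v ∧ (W ∖ R) v ∧ not (C v)) weight (suc n₀)))))
      where
      C = nextRoots W R ch

    layer-p-left : ∀ n₀ → countP (W ∖ R) ≡ suc n₀ → layer ≡ #forestsP W R
    layer-p-left n₀ eq = begin
      layer
        ≡⟨ sumL-cong (allVecs (options W R)) (λ ch _ → forestsQ-as-product n₀ eq ch) ⟩
      sumL (allVecs (options W R)) (λ ch → weightQ (W ∖ R) ^ n₀ * P*S ch)
        ≡⟨ sumL-*ˡ (allVecs (options W R)) (weightQ (W ∖ R) ^ n₀) P*S ⟩
      weightQ (W ∖ R) ^ n₀ * sumL (allVecs (options W R)) P*S
        ≡⟨ cong (weightQ (W ∖ R) ^ n₀ *_) (sumL-allVecs-prodF*sumF (options W R) (unpickedFactor N) pickedWeight) ⟩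
      weightQ (W ∖ R) ^ n₀ * sumProdExcept (λ v → sumL (options W R v) (unpickedFactor N v))
                                           (λ v → sumL (options W R v) (λ o → unpickedFactor N v o * pickedWeight v o))
        ≡⟨ cong (weightQ (W ∖ R) ^ n₀ *_) (trans (sumProdExcept-cong (options-sum-unpickedFactor N) (options-sum-pickedWeight N))
                                                 (sumProdExcept-closed (λ v → isQ v ∧ W v) weight (N + countP R) (countP R))) ⟩
      weightQ (W ∖ R) ^ n₀ * (countP R * weightQ W * weightProdQ W * (N + countP R) ^ (countQ W ∸ 1))
        ≡⟨ closed (countQ W) refl ⟩
      #forestsP W R ∎
      where
      open ≡-Reasoning
      N = suc n₀
      P*S : Choice → ℕ
      P*S ch = prodF (λ v → unpickedFactor N v (lookup ch v)) * sumF (λ v → pickedWeight v (lookup ch v))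
      closed : ∀ a → countQ W ≡ a →
               weightQ (W ∖ R) ^ n₀ * (countP R * weightQ W * weightProdQ W * (N + countP R) ^ (countQ W ∸ 1)) ≡ #forestsP W R
      closed zero eqa rewrite eqa | eq | sumF-on-empty (λ v → isQ v ∧ W v) weight eqa | *-zeroʳ (countP R) =
        *-zeroʳ (weightQ (W ∖ R) ^ n₀)
      closed (suc a) eqa rewrite eqa | eq | weightQ-∖R | countP-R | +-comm N (count R) =
        solve 5 (λ X x b P s → x :* (b :* X :* P :* s) := b :* P :* (X :* x) :* s) refl
          (weightQ W) (weightQ W ^ n₀) (count R) (weightProdQ W) ((count R + N) ^ a)

    layer-sum : layer ≡ #forestsP W R
    layer-sum = by-cases (countP (W ∖ R)) refl
      where
      by-cases : ∀ z → countP (W ∖ R) ≡ z → layer ≡ #forestsP W R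
      by-cases zero     eq = layer-no-p-left eq
      by-cases (suc n₀) eq = layer-p-left n₀ eq

  module LayerSumFromQ (W R : VertexSet) (R⊆W : ∀ v → R v ≡ true → W v ≡ true) (onQ : OnQ R) where

    countP-R : countP R ≡ 0
    countP-R = sumF-zero _ (λ u → table (isQ u) (R u) (onQ u))
      where
      table : ∀ q r → (r ≡ true → q ≡ true) → 𝟙 (not q ∧ r) ≡ 0
      table q     true  h rewrite h refl = refl
      table true  false h = refl
      table false false h = refl

    countP-∖R : countP (W ∖ R) ≡ countP W
    countP-∖R = sumF-cong (λ v → table (isQ v) (W v) (R v) (onQ v))
      where
      table : ∀ q w r → (r ≡ true → q ≡ true) → 𝟙 (not q ∧ (w ∧ not r)) ≡ 𝟙 (not q ∧ w)
      table q w     true  h rewrite h refl = refl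
      table q true  false h = refl
      table q false false h = refl

    layer : ℕ
    layer = sumL (allVecs (options W R)) (λ ch → #forestsP (W ∖ R) (nextRoots W R ch))

    unpicked : Vertex → Maybe Edge → ℕ
    unpicked v o = 𝟙 (not (isP v ∧ (W ∖ R) v ∧ not (is-just o ∧ (W ∖ R) v)))

    options-sum-unpicked : ∀ v → sumL (options W R v) (unpicked v) ≡ (if isP v ∧ W v then weightQ R else 1)
    options-sum-unpicked v = trans (sumL-options W R v (unpicked v) 1 (λ e → picked (isP v) ((W ∖ R) v)))
                                   (table (isQ v) (W v) (R v) (weight v) (countP R) (weightQ R) (onQ v) countP-R)
      where
      picked : ∀ p u → 𝟙 (not (p ∧ u ∧ not u)) ≡ 1
      picked true  true  = refl
      picked true  false = refl
      picked false u     = refl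
      table : ∀ q w r x B A → (r ≡ true → q ≡ true) → B ≡ 0 →
              𝟙 (not (not q ∧ (w ∧ not r) ∧ true)) + (if w ∧ not r then (if q then x * B else A) * 1 else 0) ≡ (if not q ∧ w then A else 1)
      table true  true  false x B A h z rewrite z | *-zeroʳ x = refl
      table true  true  true  x B A h z = refl
      table true  false r     x B A h z = refl
      table false true  false x B A h z = *-identityʳ A
      table false true  true  x B A h z = case h refl of λ ()
      table false false r     x B A h z = refl

    layer-no-q-left : countQ (W ∖ R) ≡ 0 → layer ≡ #forestsQ W R
    layer-no-q-left eq = begin
      layer
        ≡⟨ sumL-cong (allVecs (options W R)) (λ ch _ → as-product ch) ⟩
      sumL (allVecs (options W R)) (λ ch → prodF (λ v → unpicked v (lookup ch v)))
        ≡⟨ sumL-allVecs-prodF (options W R) unpicked ⟩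
      prodF (λ v → sumL (options W R v) (unpicked v))
        ≡⟨ prodF-cong options-sum-unpicked ⟩
      prodF (λ v → if isP v ∧ W v then weightQ R else 1)
        ≡⟨ prodF-const-on (λ v → isP v ∧ W v) (weightQ R) ⟩
      weightQ R ^ countP W
        ≡⟨ closed (countP W) refl ⟩
      #forestsQ W R ∎
      where
      open ≡-Reasoning
      as-product : ∀ ch → #forestsP (W ∖ R) (nextRoots W R ch) ≡ prodF (λ v → unpicked v (lookup ch v))
      as-product ch = trans (cong (λ z → forestsP-formula (W ∖ R) (nextRoots W R ch) z (countP ((W ∖ R) ∖ nextRoots W R ch))) eq)
                            (isZero-count (λ v → isP v ∧ (W ∖ R) v ∧ not (nextRoots W R ch v)))
      closed : ∀ a → countP W ≡ a → weightQ R ^ countP W ≡ #forestsQ W R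
      closed zero    eqa rewrite eqa | eq = refl
      closed (suc a) eqa rewrite eqa | eq =
        sym (trans (cong₂ (λ P X → weightQ R * P * X ^ a * 1) (prodF-on-empty (λ v → isQ v ∧ (W ∖ R) v) weight eq) weightQ-W)
                   (solve 2 (λ x y → x :* con 1 :* y :* con 1 := x :* y) refl (weightQ R) (weightQ R ^ a)))
        where
        weightQ-W : weightQ W ≡ weightQ R
        weightQ-W = trans (weightQ-∖ W R R⊆W)
                          (trans (cong (weightQ R +_) (sumF-on-empty (λ v → isQ v ∧ (W ∖ R) v) weight eq)) (+-identityʳ _))

    unpickedFactor : Vertex → Maybe Edge → ℕ
    unpickedFactor v o = if isP v ∧ (W ∖ R) v ∧ not (is-just o ∧ (W ∖ R) v) then weightQ (W ∖ R) else 1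

    picked : Vertex → Maybe Edge → ℕ
    picked v o = 𝟙 (is-just o ∧ (W ∖ R) v)

    options-sum-unpickedFactor : ∀ v → sumL (options W R v) (unpickedFactor v)
                                       ≡ (if isP v ∧ W v then (weightQ (W ∖ R) + weightQ R) * 1 else 1)
    options-sum-unpickedFactor v =
      trans (sumL-options W R v (unpickedFactor v) _ (λ e → refl))
            (table (isQ v) (W v) (R v) (weight v) (countP R) (weightQ R) (weightQ (W ∖ R)) (onQ v) countP-R)
      where
      table : ∀ q w r x B A Y → (r ≡ true → q ≡ true) → B ≡ 0 →
              (if not q ∧ (w ∧ not r) ∧ true then Y else 1)
              + (if w ∧ not r then (if q then x * B else A) * (if not q ∧ (w ∧ not r) ∧ not (w ∧ not r) then Y else 1) else 0)
              ≡ (if not q ∧ w then (Y + A) * 1 else 1)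
      table true  true  false x B A Y h z rewrite z | *-zeroʳ x = refl
      table true  true  true  x B A Y h z = refl
      table true  false r     x B A Y h z = refl
      table false true  false x B A Y h z = solve 2 (λ Y A → Y :+ A :* con 1 := (Y :+ A) :* con 1) refl Y A
      table false true  true  x B A Y h z = case h refl of λ ()
      table false false r     x B A Y h z = refl

    options-sum-picked : ∀ v → sumL (options W R v) (λ o → unpickedFactor v o * picked v o)
                               ≡ (if isP v ∧ W v then weightQ R * 1 * 1 else 0)
    options-sum-picked v =
      trans (sumL-options W R v (λ o → unpickedFactor v o * picked v o) _ (λ e → refl))
            (table (isQ v) (W v) (R v) (weight v) (countP R) (weightQ R) (weightQ (W ∖ R)) (onQ v) countP-R)
      where
      table : ∀ q w r x B A Y → (r ≡ true → q ≡ true) → B ≡ 0 →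
              (if not q ∧ (w ∧ not r) ∧ true then Y else 1) * 0
              + (if w ∧ not r then (if q then x * B else A) * ((if not q ∧ (w ∧ not r) ∧ not (w ∧ not r) then Y else 1)
                                                             * 𝟙 (w ∧ not r)) else 0)
              ≡ (if not q ∧ w then A * 1 * 1 else 0)
      table true  true  false x B A Y h z rewrite z | *-zeroʳ x = refl
      table true  true  true  x B A Y h z = refl
      table true  false r     x B A Y h z = refl
      table false true  false x B A Y h z = solve 2 (λ Y A → Y :* con 0 :+ A :* (con 1 :* con 1) := A :* con 1 :* con 1) refl Y A
      table false true  true  x B A Y h z = case h refl of λ ()
      table false false r     x B A Y h z = refl

    forestsP-as-product : ∀ m₀ → countQ (W ∖ R) ≡ suc m₀ → ∀ ch → ValidChoice W R ch →
      #forestsP (W ∖ R) (nextRoots W R ch)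
      ≡ weightProdQ (W ∖ R) * countP (W ∖ R) ^ m₀ * (prodF (λ v → unpickedFactor v (lookup ch v)) * sumF (λ v → picked v (lookup ch v)))
    forestsP-as-product m₀ eq ch valid =
      trans (cong (λ z → forestsP-formula (W ∖ R) C z (countP ((W ∖ R) ∖ C))) eq)
      (trans (cong (λ s → count C * weightProdQ (W ∖ R) * weightQ (W ∖ R) ^ countP ((W ∖ R) ∖ C) * s ^ m₀) roots+rest)
      (trans (solve 4 (λ b P X S → b :* P :* X :* S := P :* S :* (X :* b)) refl
                      (count C) (weightProdQ (W ∖ R)) (weightQ (W ∖ R) ^ countP ((W ∖ R) ∖ C)) (countP (W ∖ R) ^ m₀))
             (cong (λ X → weightProdQ (W ∖ R) * countP (W ∖ R) ^ m₀ * (X * count C))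
                   (sym (prodF-const-on (λ v → isP v ∧ (W ∖ R) v ∧ not (C v)) (weightQ (W ∖ R)))))))
      where
      C = nextRoots W R ch
      roots+rest : count C + countP ((W ∖ R) ∖ C) ≡ countP (W ∖ R)
      roots+rest = trans (sym (sumF-+ (λ v → 𝟙 (C v)) (λ v → 𝟙 (isP v ∧ (W ∖ R) v ∧ not (C v)))))
                         (sumF-cong (λ v → table (is-just (lookup ch v)) (isP v) ((W ∖ R) v)
                                                 (cong not ∘ nextRoots-onP W R ch valid onQ v)))
        where
        table : ∀ j p u → (j ∧ u ≡ true → p ≡ true) → 𝟙 (j ∧ u) + 𝟙 (p ∧ u ∧ not (j ∧ u)) ≡ 𝟙 (p ∧ u)
        table true  p     true  h rewrite h refl = refl
        table true  p     false h = refl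
        table false true  true  h = refl
        table false false true  h = refl
        table false true  false h = refl
        table false false false h = refl

    layer-q-left : ∀ m₀ → countQ (W ∖ R) ≡ suc m₀ → layer ≡ #forestsQ W R
    layer-q-left m₀ eq = begin
      layer
        ≡⟨ sumL-cong (allVecs (options W R)) (λ ch ch∈ → forestsP-as-product m₀ eq ch (∈-allVecs⇒valid W R ch∈)) ⟩
      sumL (allVecs (options W R)) (λ ch → c * P*S ch)
        ≡⟨ sumL-*ˡ (allVecs (options W R)) c P*S ⟩
      c * sumL (allVecs (options W R)) P*S
        ≡⟨ cong (c *_) (sumL-allVecs-prodF*sumF (options W R) unpickedFactor picked) ⟩
      c * sumProdExcept (λ v → sumL (options W R v) (unpickedFactor v)) (λ v → sumL (options W R v) (λ o → unpickedFactor v o * picked v o))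
        ≡⟨ cong (c *_) (trans (sumProdExcept-cong options-sum-unpickedFactor options-sum-picked)
                              (sumProdExcept-closed (λ v → isP v ∧ W v) (λ _ → 1) (weightQ (W ∖ R) + weightQ R) (weightQ R))) ⟩
      c * (weightQ R * sumF (λ v → if isP v ∧ W v then 1 else 0) * prodF (λ v → if isP v ∧ W v then 1 else 1)
             * (weightQ (W ∖ R) + weightQ R) ^ (countP W ∸ 1))
        ≡⟨ cong₂ (λ S P → c * (weightQ R * S * P * (weightQ (W ∖ R) + weightQ R) ^ (countP W ∸ 1))) indicator-sum ones-product ⟩
      c * (weightQ R * countP W * 1 * (weightQ (W ∖ R) + weightQ R) ^ (countP W ∸ 1))
        ≡⟨ cong (λ z → weightProdQ (W ∖ R) * z ^ m₀ * (weightQ R * countP W * 1 * (weightQ (W ∖ R) + weightQ R) ^ (countP W ∸ 1)))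
                countP-∖R ⟩
      weightProdQ (W ∖ R) * countP W ^ m₀ * (weightQ R * countP W * 1 * (weightQ (W ∖ R) + weightQ R) ^ (countP W ∸ 1))
        ≡⟨ closed (countP W) refl ⟩
      #forestsQ W R ∎
      where
      open ≡-Reasoning
      c = weightProdQ (W ∖ R) * countP (W ∖ R) ^ m₀
      P*S : Choice → ℕ
      P*S ch = prodF (λ v → unpickedFactor v (lookup ch v)) * sumF (λ v → picked v (lookup ch v))
      indicator-sum : sumF (λ v → if isP v ∧ W v then 1 else 0) ≡ countP W
      indicator-sum = sumF-cong (λ v → if-1-0 (isP v ∧ W v))
        where
        if-1-0 : ∀ b → (if b then 1 else 0) ≡ 𝟙 b
        if-1-0 true  = refl
        if-1-0 false = refl
      ones-product : prodF (λ v → if isP v ∧ W v then 1 else 1) ≡ 1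
      ones-product = prodF-one _ (λ v → if-1-1 (isP v ∧ W v))
        where
        if-1-1 : ∀ b → (if b then 1 else 1) ≡ 1
        if-1-1 true  = refl
        if-1-1 false = refl
      closed : ∀ a → countP W ≡ a →
               weightProdQ (W ∖ R) * countP W ^ m₀ * (weightQ R * countP W * 1 * (weightQ (W ∖ R) + weightQ R) ^ (countP W ∸ 1))
               ≡ #forestsQ W R
      closed zero eqa rewrite eqa | eq =
        solve 4 (λ P z x y → P :* z :* (x :* con 0 :* con 1 :* y) := con 0) refl
          (weightProdQ (W ∖ R)) (0 ^ m₀) (weightQ R) ((weightQ (W ∖ R) + weightQ R) ^ 0)
      closed (suc a) eqa rewrite eqa | eq =
        trans (solve 5 (λ P A Nm x S → P :* Nm :* (x :* A :* con 1 :* S) := x :* P :* S :* (A :* Nm)) refl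
                       (weightProdQ (W ∖ R)) (suc a) (suc a ^ m₀) (weightQ R) ((weightQ (W ∖ R) + weightQ R) ^ a))
              (cong (λ X → weightQ R * weightProdQ (W ∖ R) * X ^ a * (suc a * suc a ^ m₀))
                    (trans (+-comm (weightQ (W ∖ R)) (weightQ R)) (sym (weightQ-∖ W R R⊆W))))

    layer-sum : layer ≡ #forestsQ W R
    layer-sum = by-cases (countQ (W ∖ R)) refl
      where
      by-cases : ∀ z → countQ (W ∖ R) ≡ z → layer ≡ #forestsQ W R
      by-cases zero     eq = layer-no-q-left eq
      by-cases (suc m₀) eq = layer-q-left m₀ eq

  CountedEnumeration : VertexSet → VertexSet → Set
  CountedEnumeration W R = Σ (Enumeration W R) λ F →
    (OnP R → length (Enumeration.forests F) ≡ #forestsP W R) × (OnQ R → length (Enumeration.forests F) ≡ #forestsQ W R)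

  forestsP-formula-rootless : ∀ W R a b → count R ≡ 0 → 0 < a + b → forestsP-formula W R a b ≡ 0
  forestsP-formula-rootless W R zero    (suc b) _   _ = refl
  forestsP-formula-rootless W R (suc a) b       r≡0 _ rewrite r≡0 = refl

  forestsQ-formula-rootless : ∀ W R a b → weightQ R ≡ 0 → 0 < a + b → forestsQ-formula W R a b ≡ 0
  forestsQ-formula-rootless W R zero    (suc b) _   _ = refl
  forestsQ-formula-rootless W R (suc a) b       r≡0 _ rewrite r≡0 = refl

  side-count-pos : ∀ A B v → A v ≡ true → B v ≡ true → 0 < countQ A + countP B
  side-count-pos A B v av bv with isQ v in q
  ... | true  = ≤-trans (count-pos (λ u → isQ u ∧ A u) v (cong₂ _∧_ q av)) (m≤m+n _ _)
  ... | false = ≤-trans (count-pos (λ u → isP u ∧ B u) v (cong₂ (λ a b → not a ∧ b) q bv)) (m≤n+m _ _)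

  enumerate-rootless : ∀ W R → (∀ v → R v ≡ false) → (w : Maybe Vertex) → search W ≡ w → CountedEnumeration W R
  enumerate-rootless W R no-root nothing s =
    NoRoots.empty-enumeration W R no-root W≡∅ ,
    (λ _ → sym (cong₂ (forestsP-formula W R) (count-empty _ (on isQ W≡∅)) (count-empty _ (on isP ∖R≡∅)))) ,
    (λ _ → sym (cong₂ (forestsQ-formula W R) (count-empty _ (on isP W≡∅)) (count-empty _ (on isQ ∖R≡∅))))
    where
    W≡∅ : ∀ v → W v ≡ false
    W≡∅ = search-nothing W s
    ∖R≡∅ : ∀ v → (W ∖ R) v ≡ false
    ∖R≡∅ v = cong (_∧ not (R v)) (W≡∅ v)
    on : ∀ side {S : VertexSet} → (∀ v → S v ≡ false) → ∀ v → side v ∧ S v ≡ false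
    on side S≡∅ v = trans (cong (side v ∧_) (S≡∅ v)) (∧-zeroʳ (side v))
  enumerate-rootless W R no-root (just v) s =
    NoRoots.unrooted-enumeration W R no-root v wv ,
    (λ _ → sym (forestsP-formula-rootless W R (countQ W) (countP (W ∖ R)) (count-empty R no-root) (side-count-pos W (W ∖ R) v wv v∈W∖R))) ,
    (λ _ → sym (forestsQ-formula-rootless W R (countP W) (countQ (W ∖ R)) no-weight
                  (subst (0 <_) (+-comm (countQ (W ∖ R)) (countP W)) (side-count-pos (W ∖ R) W v v∈W∖R wv))))
    where
    wv : W v ≡ true
    wv = search-just W s
    v∈W∖R : (W ∖ R) v ≡ true
    v∈W∖R = ∖-intro {W} {R} wv (no-root v)
    no-weight : weightQ R ≡ 0
    no-weight = sumF-zero _ (λ u → trans (cong (λ b → if isQ u ∧ b then weight u else 0) (no-root u))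
                                         (cong (λ b → if b then weight u else 0) (∧-zeroʳ (isQ u))))

  -- Both counts are carried because the next roots lie on the other side; the fuel bounds the size of W.
  enumerate : ∀ fuel W R → (∀ v → R v ≡ true → W v ≡ true) → count W ≤ fuel → (r : Maybe Vertex) → search R ≡ r →
              CountedEnumeration W R
  enumerate fuel W R R⊆W bound nothing s = enumerate-rootless W R (search-nothing R s) (search W) refl
  enumerate zero W R R⊆W bound (just r) s =
    ⊥-elim (<⇒≱ (count-pos W r (R⊆W r (search-just R s))) bound)
  enumerate (suc fuel) W R R⊆W bound (just r) s =
    Layer.enumeration W R R⊆W inner , from-P , from-Q
    where
    rr : R r ≡ true
    rr = search-just R s
    bound′ : count (W ∖ R) ≤ fuel
    bound′ = ≤-pred (≤-trans (count-< (W ∖ R) W (λ v h → proj₁ (∖-elim {W} {R} h)) r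
                                      (trans (cong (λ b → W r ∧ not b) rr) (∧-zeroʳ (W r))) (R⊆W r rr))
                             bound)
    counted : (C : VertexSet) → (∀ v → C v ≡ true → (W ∖ R) v ≡ true) → CountedEnumeration (W ∖ R) C
    counted C C⊆ = enumerate fuel (W ∖ R) C C⊆ bound′ (search C) refl
    inner : (C : VertexSet) → (∀ v → C v ≡ true → (W ∖ R) v ≡ true) → Enumeration (W ∖ R) C
    inner C C⊆ = proj₁ (counted C C⊆)
    from-P : OnP R → length (Layer.forests W R R⊆W inner) ≡ #forestsP W R
    from-P onP = trans (Layer.length-enumeration W R R⊆W inner)
      (trans (sumL-cong (allVecs (options W R))
                (λ ch ch∈ → proj₂ (proj₂ (counted _ (nextRoots⊆∖ W R ch)))
                                  (nextRoots-onQ W R ch (∈-allVecs⇒valid W R ch∈) onP)))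
             (LayerSumFromP.layer-sum W R onP))
    from-Q : OnQ R → length (Layer.forests W R R⊆W inner) ≡ #forestsQ W R
    from-Q onQ = trans (Layer.length-enumeration W R R⊆W inner)
      (trans (sumL-cong (allVecs (options W R))
                (λ ch ch∈ → proj₁ (proj₂ (counted _ (nextRoots⊆∖ W R ch)))
                                  (nextRoots-onP W R ch (∈-allVecs⇒valid W R ch∈) onQ)))
             (LayerSumFromQ.layer-sum W R R⊆W onQ))

module SpanningTrees (m₀ n₀ : ℕ) (k : Fin (suc m₀) → ℕ) where

  open CompleteBipartite (suc m₀) (suc n₀) k
  open RootedForests G loopless

  p₀ : Vertex
  p₀ = pv zero

  rooted-at-p₀ : CountedEnumeration allVertices (singleton p₀)
  rooted-at-p₀ = enumerate (suc n₀ + suc m₀) allVertices (singleton p₀) (λ _ _ → refl)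
                           (≤-reflexive (sumF-ones (suc n₀ + suc m₀))) (search (singleton p₀)) refl

  p₀-onP : OnP (singleton p₀)
  p₀-onP v h = trans (cong isQ (≡ᵇ⇒≡ {i = v} h)) (isQ-pv zero)

  countQ-all : countQ allVertices ≡ suc m₀
  countQ-all = trans (sumF-↑ (suc n₀) (λ v → 𝟙 (isQ v ∧ true)))
    (cong₂ _+_ (sumF-zero _ (λ j → cong (λ b → 𝟙 (b ∧ true)) (isQ-pv j)))
               (trans (sumF-cong (λ i → cong (λ b → 𝟙 (b ∧ true)) (isQ-qv i))) (sumF-ones (suc m₀))))

  countP-others : countP (allVertices ∖ singleton p₀) ≡ n₀
  countP-others = trans (sumF-↑ (suc n₀) (λ v → 𝟙 (isP v ∧ true ∧ not (v ≡ᵇ p₀))))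
    (trans (cong₂ _+_ on-p (sumF-zero _ (λ i → cong (λ b → 𝟙 (not b ∧ true ∧ not (qv i ≡ᵇ p₀))) (isQ-qv i))))
           (+-identityʳ n₀))
    where
    on-p : sumF (λ j → 𝟙 (isP (pv j) ∧ true ∧ not (pv j ≡ᵇ p₀))) ≡ n₀
    on-p = trans (sumF-cong (λ j → cong (λ b → 𝟙 (not b ∧ true ∧ not (pv j ≡ᵇ p₀))) (isQ-pv j)))
                 (trans (cong₂ _+_ (cong (λ b → 𝟙 (not b)) (≡ᵇ-refl p₀))
                                   (sumF-cong (λ j → cong (λ b → 𝟙 (not b)) (pv-≡ᵇ (suc j) zero))))
                        (sumF-ones n₀))

  count-p₀ : count (singleton p₀) ≡ 1
  count-p₀ = trans (sumF-↑ (suc n₀) (λ v → 𝟙 (v ≡ᵇ p₀)))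
    (cong₂ _+_ (cong₂ _+_ (cong 𝟙 (≡ᵇ-refl p₀)) (sumF-zero _ (λ j → cong 𝟙 (pv-≡ᵇ (suc j) zero))))
               (sumF-zero _ (λ i → cong 𝟙 (≢⇒≡ᵇ-false (qv≢pv i zero)))))

  weightProdQ-all : weightProdQ allVertices ≡ prodF k
  weightProdQ-all = trans (prodF-↑ (suc n₀) (λ v → if isQ v ∧ true then weight v else 1))
    (trans (cong₂ _*_ (prodF-one _ (λ j → cong (λ b → if b ∧ true then weight (pv j) else 1) (isQ-pv j)))
                      (prodF-cong (λ i → trans (cong (λ b → if b ∧ true then weight (qv i) else 1) (isQ-qv i)) (weight-qv i))))
           (+-identityʳ _))

  weightQ-all : weightQ allVertices ≡ sumF k
  weightQ-all = trans (sumF-↑ (suc n₀) (λ v → if isQ v ∧ true then weight v else 0))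
    (cong₂ _+_ (sumF-zero _ (λ j → cong (λ b → if b ∧ true then weight (pv j) else 0) (isQ-pv j)))
               (sumF-cong (λ i → trans (cong (λ b → if b ∧ true then weight (qv i) else 0) (isQ-qv i)) (weight-qv i))))

  #forestsP-p₀ : #forestsP allVertices (singleton p₀)
                 ≡ suc n₀ ^ m₀ * product (map k (allFin (suc m₀))) * sum (map k (allFin (suc m₀))) ^ n₀
  #forestsP-p₀ = begin
    #forestsP allVertices (singleton p₀)
      ≡⟨ cong₂ (forestsP-formula allVertices (singleton p₀)) countQ-all countP-others ⟩
    count (singleton p₀) * weightProdQ allVertices * weightQ allVertices ^ n₀ * (count (singleton p₀) + n₀) ^ m₀
      ≡⟨ cong₂ (λ c P → c * P * weightQ allVertices ^ n₀ * (c + n₀) ^ m₀) count-p₀ weightProdQ-all ⟩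
    1 * prodF k * weightQ allVertices ^ n₀ * suc n₀ ^ m₀
      ≡⟨ cong (λ X → 1 * prodF k * X ^ n₀ * suc n₀ ^ m₀) weightQ-all ⟩
    1 * prodF k * sumF k ^ n₀ * suc n₀ ^ m₀
      ≡⟨ solve 3 (λ P X N → con 1 :* P :* X :* N := N :* P :* X) refl (prodF k) (sumF k ^ n₀) (suc n₀ ^ m₀) ⟩
    suc n₀ ^ m₀ * prodF k * sumF k ^ n₀
      ≡⟨ cong₂ (λ P X → suc n₀ ^ m₀ * P * X ^ n₀) (sym (product-map-tabulate (λ i → i) k)) (sym (sum-map-tabulate (λ i → i) k)) ⟩
    suc n₀ ^ m₀ * product (map k (allFin (suc m₀))) * sum (map k (allFin (suc m₀))) ^ n₀ ∎
    where open ≡-Reasoning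

theorem4p2 : (m n : ℕ) → 1 ≤ m → 1 ≤ n → (k : Fin m → ℕ) → (∀ i → 1 ≤ k i) →
    SpanningTreeCount (genCompleteBipartite m n k)
    (n ^ (m ∸ 1) * product (map k (allFin m)) * sum (map k (allFin m)) ^ (n ∸ 1))
theorem4p2 (suc m₀) (suc n₀) _ _ k _ =
  forests F , unique F , trans (proj₁ counted p₀-onP) #forestsP-p₀ ,
  λ S → (λ S∈ → forest⇒spanningTree p₀ S (sound F S S∈)) , (λ tree → complete F S (spanningTree⇒forest p₀ S tree))
  where
  open SpanningTrees m₀ n₀ k
  open CompleteBipartite (suc m₀) (suc n₀) k using (G; loopless)
  open RootedForests G loopless
  open Enumeration
  F = proj₁ rooted-at-p₀
  counted = proj₂ rooted-at-p₀
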